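{- Let $D\in\mathcal{F}_n$, write $W=W(D)$, let $Q\in\Gamma(D)$, and define $\bar Q=d_n(W)\,Q$ (an integral matrix). Then for every odd prime $p$ dividing $\ell(Q)$: (i) $\bar Q^T\bar Q\equiv 0\pmod{p^2}$; (ii) $\operatorname{rank}_p(\bar Q)=1$.
   Context: An oriented graph on vertices $v_1,\dots,v_n$ is a digraph obtained from a simple undirected graph by orienting each edge. Its skew-adjacency matrix $S(D)=(s_{ij})$ has $s_{ij}=1$ if $(v_i,v_j)$ is an arc, $s_{ij}=-1$ if $(v_j,v_i)$ is an arc, and $0$ otherwise. Let $e$ be the all-ones vector of length $n$. The skew-walk matrix is $W(D)=[e,S(D)e,\dots,S(D)^{n-1}e]$. $\mathcal{F}_n$ is the set of oriented graphs $D$ of order $n$ such that $2^{ -\lfloor n/2\rfloor}\det W(D)$ is an odd square-free integer. $\Gamma(D)$ is the set of all $n\times n$ orthogonal matrices $Q$ with rational entries such that $Qe=e$ and $Q^TS(D)Q=S(C)$ for some oriented graph $C$. The level $\ell(Q)$ of a rational orthogonal matrix $Q$ is the smallest positive integer $x$ with $xQ$ integral. For a nonsingular integral matrix $M$, $d_n(M)$ is its largest invariant factor (last diagonal entry of its Smith normal form). For a prime $p$ and an integral matrix $M$, $\operatorname{rank}_p(M)$ is the rank of $M$ reduced modulo $p$, over the field $\mathbb{F}_p$. -}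

module Defs where

open import Data.Nat as ℕ using (ℕ; zero; suc)
open import Data.Nat.Divisibility as ℕD using ()
open import Data.Integer as ℤ using (ℤ; +_; -[1+_])
open import Data.Integer.Divisibility as ℤD using ()
open import Data.Rational as ℚ using (ℚ)
open import Data.Fin as Fin using (Fin; toℕ; fromℕ; punchIn)
open import Data.Bool using (Bool; true; false; if_then_else_)
open import Data.Product using (Σ; _×_; _,_)
open import Data.Empty using (⊥)
open import Relation.Binary.PropositionalEquality using (_≡_; _≢_)
open import Relation.Nullary using (¬_)
open import Function.Definitions using (Injective)

Mat : Set → ℕ → Set
Mat A n = Fin n → Fin n → A

Vec : Set → ℕ → Set
Vec A n = Fin n → A

∑ℤ : ∀ {n} → (Fin n → ℤ) → ℤ
∑ℤ {zero}  f = + 0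
∑ℤ {suc n} f = f Fin.zero ℤ.+ ∑ℤ (λ i → f (Fin.suc i))

∑ℚ : ∀ {n} → (Fin n → ℚ) → ℚ
∑ℚ {zero}  f = ℚ.0ℚ
∑ℚ {suc n} f = f Fin.zero ℚ.+ ∑ℚ (λ i → f (Fin.suc i))

_*ℤ_ : ∀ {n} → Mat ℤ n → Mat ℤ n → Mat ℤ n
(A *ℤ B) i j = ∑ℤ (λ k → A i k ℤ.* B k j)

_*ℚ_ : ∀ {n} → Mat ℚ n → Mat ℚ n → Mat ℚ n
(A *ℚ B) i j = ∑ℚ (λ k → A i k ℚ.* B k j)

_·ℤ_ : ∀ {n} → Mat ℤ n → Vec ℤ n → Vec ℤ n
(A ·ℤ v) i = ∑ℤ (λ k → A i k ℤ.* v k)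

_·ℚ_ : ∀ {n} → Mat ℚ n → Vec ℚ n → Vec ℚ n
(A ·ℚ v) i = ∑ℚ (λ k → A i k ℚ.* v k)

transpose : ∀ {A : Set} {n} → Mat A n → Mat A n
transpose M i j = M j i

idℚ : ∀ {n} → Mat ℚ n
idℚ i j with i Fin.≟ j
... | Relation.Nullary.yes _ = ℚ.1ℚ
... | Relation.Nullary.no  _ = ℚ.0ℚ

toℚ : ℤ → ℚ
toℚ z = z ℚ./ 1

toℚMat : ∀ {n} → Mat ℤ n → Mat ℚ n
toℚMat M i j = toℚ (M i j)

sgn : ℕ → ℤ
sgn zero          = + 1
sgn (suc zero)    = ℤ.- (+ 1)
sgn (suc (suc k)) = sgn k

det : ∀ {n} → Mat ℤ n → ℤ
det {zero}  M = + 1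
det {suc n} M =
  ∑ℤ (λ j → sgn (toℕ j) ℤ.* (M Fin.zero j ℤ.* det (λ i k → M (Fin.suc i) (punchIn j k))))

-- oriented graphs on vertex set Fin n: arc i j = true iff (v_i, v_j) is an arc;
-- no loops and at most one orientation per pair (orientation of a simple graph)
record OrientedGraph (n : ℕ) : Set where
  field
    arc    : Fin n → Fin n → Bool
    irrefl : ∀ i → arc i i ≡ false
    asym   : ∀ i j → arc i j ≡ true → arc j i ≡ false
open OrientedGraph public

skew : ∀ {n} → OrientedGraph n → Mat ℤ n
skew D i j = if arc D i j then + 1 else (if arc D j i then ℤ.- (+ 1) else + 0)

ones : ∀ {n} → Vec ℤ n
ones _ = + 1

walkVec : ∀ {n} → OrientedGraph n → ℕ → Vec ℤ n
walkVec D zero    = ones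
walkVec D (suc k) = skew D ·ℤ walkVec D k

walkMatrix : ∀ {n} → OrientedGraph n → Mat ℤ n
walkMatrix D i j = walkVec D (toℕ j) i

SquareFree : ℤ → Set
SquareFree m = ∀ (k : ℕ) → (k ℕ.* k) ℕD.∣ ℤ.∣ m ∣ → k ≡ 1

Odd : ℤ → Set
Odd m = ¬ ((+ 2) ℤD.∣ m)

InF : ∀ {n} → OrientedGraph n → Set
InF {n} D = Σ ℤ (λ m → det (walkMatrix D) ≡ (+ (2 ℕ.^ (n ℕ./ 2))) ℤ.* m × Odd m × SquareFree m)

InΓ : ∀ {n} → OrientedGraph n → Mat ℚ n → Set
InΓ {n} D Q =
  (∀ i j → (transpose Q *ℚ Q) i j ≡ idℚ i j) ×
  (∀ i → (Q ·ℚ (λ _ → ℚ.1ℚ)) i ≡ ℚ.1ℚ) ×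
  Σ (OrientedGraph n) (λ C → ∀ i j → (transpose Q *ℚ (toℚMat (skew D) *ℚ Q)) i j ≡ toℚMat (skew C) i j)

IsIntegral : ℚ → Set
IsIntegral q = Σ ℤ (λ z → q ≡ toℚ z)

IntegralMat : ∀ {n} → Mat ℚ n → Set
IntegralMat M = ∀ i j → IsIntegral (M i j)

scaleℚ : ∀ {n} → ℕ → Mat ℚ n → Mat ℚ n
scaleℚ x M i j = toℚ (+ x) ℚ.* M i j

IsLevel : ∀ {n} → Mat ℚ n → ℕ → Set
IsLevel Q ℓ = (ℕ.NonZero ℓ) × IntegralMat (scaleℚ ℓ Q) ×
  (∀ (x : ℕ) → ℕ.NonZero x → IntegralMat (scaleℚ x Q) → ℓ ℕ.≤ x)

Unimodular : ∀ {n} → Mat ℤ n → Set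
Unimodular M = ℤ.∣ det M ∣ ≡ 1

diagℤ : ∀ {n} → (Fin n → ℕ) → Mat ℤ n
diagℤ δ i j with i Fin.≟ j
... | Relation.Nullary.yes _ = + (δ i)
... | Relation.Nullary.no  _ = + 0

IsSmithForm : ∀ {n} → Mat ℤ n → (Fin n → ℕ) → Set
IsSmithForm {n} M δ =
  Σ (Mat ℤ n) (λ U → Σ (Mat ℤ n) (λ V →
    Unimodular U × Unimodular V × (∀ i j → ((U *ℤ M) *ℤ V) i j ≡ diagℤ δ i j))) ×
  (∀ i → ℕ.NonZero (δ i)) ×
  (∀ i j → i Fin.≤ j → δ i ℕD.∣ δ j)

IsLargestInvariantFactor : ∀ {n} → Mat ℤ n → ℕ → Set
IsLargestInvariantFactor {zero}  M d = d ≡ 1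
IsLargestInvariantFactor {suc m} M d =
  Σ (Fin (suc m) → ℕ) (λ δ → IsSmithForm M δ × d ≡ δ (fromℕ m))

IndependentColsMod : ∀ {n r} → ℕ → Mat ℤ n → (Fin r → Fin n) → Set
IndependentColsMod {n} {r} p M f =
  ∀ (a : Fin r → ℤ) →
    (∀ i → (+ p) ℤD.∣ ∑ℤ (λ k → a k ℤ.* M i (f k))) →
    ∀ k → (+ p) ℤD.∣ a k

HasRankMod : ∀ {n} → ℕ → Mat ℤ n → ℕ → Set
HasRankMod {n} p M r =
  Σ (Fin r → Fin n) (λ f → Injective _≡_ _≡_ f × IndependentColsMod p M f) ×
  (∀ (g : Fin (suc r) → Fin n) → Injective _≡_ _≡_ g → ¬ IndependentColsMod p M g)

{-# OPTIONS --safe #-}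
module Submission where

-- R = ℓQ is integral, and QᵀQ = I, Qe = e, QᵀS(D)Q = S(C) become RᵀR = ℓ²I, Re = ℓe, RᵀS(D)R = ℓ²S(C);
-- a trace argument gives RRᵀ = ℓ²I, hence S(D)R = RS(C) and RᵀW(D) = ℓW(C). Writing the Smith form as
-- UWV = diag δ, the matrix dW⁻¹ = V(dΔ⁻¹)U is integral, so ℓ divides dR and Q̄ = dQ = (d/ℓ)R is integral
-- with Q̄ᵀQ̄ = d²I and Q̄ᵀW(D) = dW(C). Since 2^{-⌊n/2⌋} det W is odd and square-free, p² ∤ det W; as δₙ
-- divides (row n of U)·W and that row is nonzero mod p, also p² ∤ d. Minimality of ℓ gives an entry of R
-- prime to p, so p | d and the corresponding entry of Q̄ is prime to p. Thus p² divides Q̄ᵀQ̄ = d²I, and the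
-- columns of Q̄ lie in the left kernel of W mod p, which is at most one-dimensional because two independent
-- kernel vectors would force p² | det W.

open import Defs
open import Data.Nat as ℕ using (ℕ; zero; suc)
import Data.Nat.Properties as ℕP
import Data.Nat.Divisibility as ℕD
open import Data.Nat.Primality using (Prime; euclidsLemma; ¬prime[1]; prime⇒nonZero; prime⇒nonTrivial; irreducible[2])
open import Data.Integer as ℤ using (ℤ; +_; -[1+_]; _+_; _*_; -_; _-_)
import Data.Integer.Properties as ℤP
open import Data.Integer.Divisibility.Signed as ℤS using (divides; quotient; ∣ᵤ⇒∣; ∣⇒∣ᵤ)
import Data.Integer.Divisibility as ℤD
open import Data.Integer.Tactic.RingSolver using (solve-∀)
open import Data.Rational as ℚ using (ℚ)
import Data.Rational.Properties as ℚP
import Data.Rational.Unnormalised as ℚᵘ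
import Data.Rational.Unnormalised.Properties as ℚᵘP
import Data.Nat.Coprimality as Coprime
open import Data.Fin as Fin using (Fin; zero; suc; toℕ; punchIn; punchOut; fromℕ)
import Data.Fin.Properties as FinP
open import Data.Product using (Σ; ∃; _×_; _,_; proj₁; proj₂; map₂)
open import Data.Sum using (_⊎_; inj₁; inj₂; [_,_]′; reduce)
open import Data.Empty using (⊥-elim)
open import Function using (_∘_; flip)
open import Function.Definitions using (Injective)
open import Relation.Nullary using (¬_; Dec; yes; no)
open import Relation.Binary.PropositionalEquality
open import Algebra.Bundles using (Ring)
import Algebra.Properties.Semiring.Sum ℤP.+-*-semiring as ΣL
import Algebra.Properties.Monoid.Sum ℕP.+-0-monoid as ΣN
import Algebra.Properties.Semiring.Sum (Ring.semiring ℚP.+-*-ring) as ΣQ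
open import Data.Rational.Solver using () renaming (module +-*-Solver to ℚSolver)

variable
  n : ℕ

∑ℤ≡sum : (f : Fin n → ℤ) → ∑ℤ f ≡ ΣL.sum f
∑ℤ≡sum {zero} f = refl
∑ℤ≡sum {suc n} f = cong (λ s → f zero + s) (∑ℤ≡sum (f ∘ suc))

∑-cong : {f g : Fin n → ℤ} → (∀ i → f i ≡ g i) → ∑ℤ f ≡ ∑ℤ g
∑-cong {f = f} {g} f≗g = trans (∑ℤ≡sum f) (trans (ΣL.sum-cong-≗ f≗g) (sym (∑ℤ≡sum g)))

∑-+ : (f g : Fin n → ℤ) → ∑ℤ (λ i → f i + g i) ≡ ∑ℤ f + ∑ℤ g
∑-+ f g = trans (∑ℤ≡sum (λ i → f i + g i)) (trans (ΣL.∑-distrib-+ f g) (sym (cong₂ _+_ (∑ℤ≡sum f) (∑ℤ≡sum g))))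

∑-*ˡ : (c : ℤ) (f : Fin n → ℤ) → ∑ℤ (λ i → c * f i) ≡ c * ∑ℤ f
∑-*ˡ c f = trans (∑ℤ≡sum (λ i → c * f i)) (trans (sym (ΣL.*-distribˡ-sum c f)) (cong (c *_) (sym (∑ℤ≡sum f))))

∑-*ʳ : (c : ℤ) (f : Fin n → ℤ) → ∑ℤ (λ i → f i * c) ≡ ∑ℤ f * c
∑-*ʳ c f = trans (∑ℤ≡sum (λ i → f i * c)) (trans (sym (ΣL.*-distribʳ-sum c f)) (cong (_* c) (sym (∑ℤ≡sum f))))

∑-comm : ∀ {m} (F : Fin m → Fin n → ℤ) → ∑ℤ (λ i → ∑ℤ (F i)) ≡ ∑ℤ (λ j → ∑ℤ (λ i → F i j))
∑-comm F = trans (∑∑≡ F) (trans (ΣL.∑-comm F) (sym (∑∑≡ (flip F))))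
  where
  ∑∑≡ : ∀ {a b} (G : Fin a → Fin b → ℤ) → ∑ℤ (λ i → ∑ℤ (G i)) ≡ ΣL.sum (λ i → ΣL.sum (G i))
  ∑∑≡ G = trans (∑ℤ≡sum (λ i → ∑ℤ (G i))) (ΣL.sum-cong-≗ (λ i → ∑ℤ≡sum (G i)))

∑-zero : {f : Fin n → ℤ} → (∀ i → f i ≡ + 0) → ∑ℤ f ≡ + 0
∑-zero {zero} _ = refl
∑-zero {suc n} f≗0 = cong₂ _+_ (f≗0 zero) (∑-zero (f≗0 ∘ suc))

∑-single : (f : Fin n → ℤ) (k : Fin n) → (∀ i → i ≢ k → f i ≡ + 0) → ∑ℤ f ≡ f k
∑-single f zero others = trans (cong (λ s → f zero + s) (∑-zero (λ i → others (suc i) λ ()))) (ℤP.+-identityʳ _)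
∑-single f (suc k) others =
  trans (cong₂ _+_ (others zero λ ()) (∑-single (f ∘ suc) k (λ i i≢k → others (suc i) (i≢k ∘ FinP.suc-injective))))
        (ℤP.+-identityˡ _)

∑-∣ : ∀ {d} {f : Fin n → ℤ} → (∀ i → d ℤS.∣ f i) → d ℤS.∣ ∑ℤ f
∑-∣ {zero} _ = divides (+ 0) refl
∑-∣ {suc n} d∣f = ℤS.∣m∣n⇒∣m+n (d∣f zero) (∑-∣ (d∣f ∘ suc))

∑-squares≡0 : (E : Mat ℤ n) → ∑ℤ (λ i → ∑ℤ (λ j → E i j * E i j)) ≡ + 0 → ∀ i j → E i j ≡ + 0
∑-squares≡0 E ∑E²≡0 i j =
  reduce (ℤP.i*j≡0⇒i≡0∨j≡0 (E i j) (trans (square (E i j)) (cong +_ (sum≡0 (h i) (sum≡0 (ΣN.sum ∘ h) total i) j))))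
  where
  h : Fin _ → Fin _ → ℕ
  h i j = ℤ.∣ E i j ∣ ℕ.* ℤ.∣ E i j ∣
  square : ∀ x → x * x ≡ + (ℤ.∣ x ∣ ℕ.* ℤ.∣ x ∣)
  square (+ m) = sym (ℤP.pos-* m m)
  square -[1+ m ] = refl
  ∑-pos : ∀ {m} (g : Fin m → ℕ) → ∑ℤ (λ i → + g i) ≡ + ΣN.sum g
  ∑-pos {zero} g = refl
  ∑-pos {suc m} g = trans (cong (λ s → + g zero + s) (∑-pos (g ∘ suc))) (sym (ℤP.pos-+ (g zero) _))
  sum≡0 : ∀ {m} (g : Fin m → ℕ) → ΣN.sum g ≡ 0 → ∀ i → g i ≡ 0
  sum≡0 g ∑g≡0 zero = ℕP.m+n≡0⇒m≡0 (g zero) ∑g≡0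
  sum≡0 g ∑g≡0 (suc i) = sum≡0 (g ∘ suc) (ℕP.m+n≡0⇒n≡0 (g zero) ∑g≡0) i
  total : ΣN.sum (λ i → ΣN.sum (h i)) ≡ 0
  total = ℤP.+-injective (begin
      + ΣN.sum (λ i → ΣN.sum (h i))           ≡⟨ sym (∑-pos (λ i → ΣN.sum (h i))) ⟩
      ∑ℤ (λ i → + ΣN.sum (h i))               ≡⟨ ∑-cong (λ i → sym (∑-pos (h i))) ⟩
      ∑ℤ (λ i → ∑ℤ (λ j → + h i j))           ≡⟨ ∑-cong (λ i → ∑-cong (λ j → sym (square (E i j)))) ⟩
      ∑ℤ (λ i → ∑ℤ (λ j → E i j * E i j))     ≡⟨ ∑E²≡0 ⟩
      + 0                                     ∎)
    where open ≡-Reasoning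

infix 4 _≋_
_≋_ : Mat ℤ n → Mat ℤ n → Set
A ≋ B = ∀ i j → A i j ≡ B i j

infixr 7 _•_
_•_ : ℤ → Mat ℤ n → Mat ℤ n
(c • A) i j = c * A i j

diagℤ-diag : (δ : Fin n → ℕ) (i : Fin n) → diagℤ δ i i ≡ + δ i
diagℤ-diag δ i with i Fin.≟ i
... | yes _ = refl
... | no i≢i = ⊥-elim (i≢i refl)

diagℤ-off : (δ : Fin n → ℕ) {i j : Fin n} → i ≢ j → diagℤ δ i j ≡ + 0
diagℤ-off δ {i} {j} i≢j with i Fin.≟ j
... | yes i≡j = ⊥-elim (i≢j i≡j)
... | no _ = refl

∑-diagℤˡ : (δ : Fin n → ℕ) (i : Fin n) (f : Fin n → ℤ) → ∑ℤ (λ j → diagℤ δ i j * f j) ≡ + δ i * f i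
∑-diagℤˡ δ i f =
  trans (∑-single _ i (λ j j≢i → trans (cong (_* f j) (diagℤ-off δ (j≢i ∘ sym))) (ℤP.*-zeroˡ (f j))))
        (cong (_* f i) (diagℤ-diag δ i))

∑-diagℤʳ : (δ : Fin n → ℕ) (i : Fin n) (f : Fin n → ℤ) → ∑ℤ (λ j → f j * diagℤ δ j i) ≡ f i * + δ i
∑-diagℤʳ δ i f =
  trans (∑-single _ i (λ j j≢i → trans (cong (f j *_) (diagℤ-off δ j≢i)) (ℤP.*-zeroʳ (f j))))
        (cong (f i *_) (diagℤ-diag δ i))

idℤ : Mat ℤ n
idℤ = diagℤ (λ _ → 1)

idℤ-sym : (i j : Fin n) → idℤ i j ≡ idℤ j i
idℤ-sym i j = by-cases (i Fin.≟ j)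
  where
  by-cases : Dec (i ≡ j) → idℤ i j ≡ idℤ j i
  by-cases (yes refl) = refl
  by-cases (no i≢j) = trans (diagℤ-off _ i≢j) (sym (diagℤ-off _ (i≢j ∘ sym)))

∑-idℤˡ : (i : Fin n) (f : Fin n → ℤ) → ∑ℤ (λ j → idℤ i j * f j) ≡ f i
∑-idℤˡ i f = trans (∑-diagℤˡ _ i f) (ℤP.*-identityˡ (f i))

∑-idℤʳ : (i : Fin n) (f : Fin n → ℤ) → ∑ℤ (λ j → f j * idℤ j i) ≡ f i
∑-idℤʳ i f = trans (∑-diagℤʳ _ i f) (ℤP.*-identityʳ (f i))

*-identityˡ : (A : Mat ℤ n) → idℤ *ℤ A ≋ A
*-identityˡ A i j = ∑-idℤˡ i (λ k → A k j)

*-identityʳ : (A : Mat ℤ n) → A *ℤ idℤ ≋ A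
*-identityʳ A i j = ∑-idℤʳ j (A i)

*-diagℤ : (X : Mat ℤ n) (δ : Fin n → ℕ) → ∀ a b → (X *ℤ diagℤ δ) a b ≡ X a b * + δ b
*-diagℤ X δ a b = ∑-diagℤʳ δ b (X a)

diagℤ-* : (δ : Fin n → ℕ) (X : Mat ℤ n) → ∀ a b → (diagℤ δ *ℤ X) a b ≡ + δ a * X a b
diagℤ-* δ X a b = ∑-diagℤˡ δ a (λ k → X k b)

*-congˡ : {A A′ : Mat ℤ n} (B : Mat ℤ n) → A ≋ A′ → A *ℤ B ≋ A′ *ℤ B
*-congˡ B A≋A′ i j = ∑-cong (λ k → cong (_* B k j) (A≋A′ i k))

*-congʳ : (A : Mat ℤ n) {B B′ : Mat ℤ n} → B ≋ B′ → A *ℤ B ≋ A *ℤ B′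
*-congʳ A B≋B′ i j = ∑-cong (λ k → cong (A i k *_) (B≋B′ k j))

*-assoc : (A B C : Mat ℤ n) → (A *ℤ B) *ℤ C ≋ A *ℤ (B *ℤ C)
*-assoc A B C i j = begin
  ∑ℤ (λ k → ∑ℤ (λ l → A i l * B l k) * C k j)   ≡⟨ ∑-cong (λ k → sym (∑-*ʳ (C k j) (λ l → A i l * B l k))) ⟩
  ∑ℤ (λ k → ∑ℤ (λ l → A i l * B l k * C k j))   ≡⟨ ∑-comm (λ k l → A i l * B l k * C k j) ⟩
  ∑ℤ (λ l → ∑ℤ (λ k → A i l * B l k * C k j))   ≡⟨ ∑-cong (λ l → trans (∑-cong (λ k → ℤP.*-assoc (A i l) (B l k) (C k j)))
                                                                       (∑-*ˡ (A i l) (λ k → B l k * C k j))) ⟩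
  ∑ℤ (λ l → A i l * ∑ℤ (λ k → B l k * C k j))   ∎
  where open ≡-Reasoning

•-*ˡ : (c : ℤ) (A B : Mat ℤ n) → (c • A) *ℤ B ≋ c • (A *ℤ B)
•-*ˡ c A B i j = trans (∑-cong (λ k → ℤP.*-assoc c (A i k) (B k j))) (∑-*ˡ c (λ k → A i k * B k j))

•-*ʳ : (c : ℤ) (A B : Mat ℤ n) → A *ℤ (c • B) ≋ c • (A *ℤ B)
•-*ʳ c A B i j = trans (∑-cong (λ k → x*[c*y]≡c*[x*y] (A i k) c (B k j))) (∑-*ˡ c (λ k → A i k * B k j))
  where
  x*[c*y]≡c*[x*y] : ∀ x c y → x * (c * y) ≡ c * (x * y)
  x*[c*y]≡c*[x*y] = solve-∀

•-cancel : (c : ℤ) .{{_ : ℤ.NonZero c}} {A B : Mat ℤ n} → c • A ≋ c • B → A ≋ B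
•-cancel c cA≋cB i j = ℤP.*-cancelˡ-≡ c _ _ (cA≋cB i j)

-- A vector v is the common column of the matrix (λ k _ → v k), and a covector u the common row of (λ _ → u).
·-assoc : (A B : Mat ℤ n) (v : Fin n → ℤ) (i : Fin n) → (A ·ℤ (B ·ℤ v)) i ≡ ((A *ℤ B) ·ℤ v) i
·-assoc A B v i = sym (*-assoc A B (λ k _ → v k) i i)

infixl 7 _ᵀ·_
_ᵀ·_ : (Fin n → ℤ) → Mat ℤ n → (Fin n → ℤ)
(u ᵀ· A) c = ∑ℤ (λ t → u t * A t c)

ᵀ·-assoc : (u : Fin n → ℤ) (A B : Mat ℤ n) (c : Fin n) → (u ᵀ· A ᵀ· B) c ≡ (u ᵀ· (A *ℤ B)) c
ᵀ·-assoc u A B c = *-assoc (λ _ → u) A B c c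

ᵀ·-lincomb : (a b : ℤ) (x y : Fin n → ℤ) (A : Mat ℤ n) (c : Fin n) →
  ((λ t → a * x t + b * y t) ᵀ· A) c ≡ a * (x ᵀ· A) c + b * (y ᵀ· A) c
ᵀ·-lincomb a b x y A c = begin
    ∑ℤ (λ t → (a * x t + b * y t) * A t c)
  ≡⟨ ∑-cong (λ t → distrib a b (x t) (y t) (A t c)) ⟩
    ∑ℤ (λ t → a * (x t * A t c) + b * (y t * A t c))
  ≡⟨ ∑-+ (λ t → a * (x t * A t c)) (λ t → b * (y t * A t c)) ⟩
    ∑ℤ (λ t → a * (x t * A t c)) + ∑ℤ (λ t → b * (y t * A t c))
  ≡⟨ cong₂ _+_ (∑-*ˡ a (λ t → x t * A t c)) (∑-*ˡ b (λ t → y t * A t c)) ⟩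
    a * (x ᵀ· A) c + b * (y ᵀ· A) c
  ∎
  where
  open ≡-Reasoning
  distrib : ∀ a b x y m → (a * x + b * y) * m ≡ a * (x * m) + b * (y * m)
  distrib = solve-∀

-- Determinants

sgn-suc : ∀ k → sgn (suc k) ≡ - sgn k
sgn-suc zero = refl
sgn-suc (suc k) = trans (sym (ℤP.neg-involutive (sgn k))) (cong -_ (sym (sgn-suc k)))

sgn-involutive : ∀ k x → sgn k * (sgn k * x) ≡ x
sgn-involutive k x = trans (sym (ℤP.*-assoc (sgn k) (sgn k) x)) (trans (cong (_* x) (sgn² k)) (ℤP.*-identityˡ x))
  where
  sgn² : ∀ k → sgn k * sgn k ≡ + 1
  sgn² zero = refl
  sgn² (suc zero) = refl
  sgn² (suc (suc k)) = sgn² k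

minor : Fin (suc n) → Mat ℤ (suc n) → Mat ℤ n
minor j A i k = A (suc i) (punchIn j k)

det-cong : {A B : Mat ℤ n} → A ≋ B → det A ≡ det B
det-cong {zero} _ = refl
det-cong {suc n} A≋B =
  ∑-cong (λ j → cong₂ (λ a m → sgn (toℕ j) * (a * m)) (A≋B zero j) (det-cong (λ i k → A≋B (suc i) (punchIn j k))))

-- Expanding along row 0 and then along column 0 of the minors, or the other way round, gives the same double sum.
det-expand-col0 : (A : Mat ℤ (suc n)) →
  det A ≡ ∑ℤ (λ i → sgn (toℕ i) * (A i zero * det (λ r k → A (punchIn i r) (suc k))))
det-expand-col0 {zero} A = refl
det-expand-col0 {suc n} A = cong (λ s → sgn 0 * (A zero zero * det (minor zero A)) + s) (begin
    ∑ℤ (λ j → sgn (toℕ (suc j)) * (a j * det (minor (suc j) A)))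
  ≡⟨ ∑-cong (λ j → cong (λ m → sgn (toℕ (suc j)) * (a j * m)) (det-expand-col0 (minor (suc j) A))) ⟩
    ∑ℤ (λ j → sgn (toℕ (suc j)) * (a j * ∑ℤ (λ i → sgn (toℕ i) * (b i * M i j))))
  ≡⟨ ∑-cong (λ j → pull (sgn (toℕ (suc j))) (a j) (λ i → sgn (toℕ i) * (b i * M i j))) ⟩
    ∑ℤ (λ j → ∑ℤ (λ i → sgn (toℕ (suc j)) * (a j * (sgn (toℕ i) * (b i * M i j)))))
  ≡⟨ ∑-comm (λ j i → sgn (toℕ (suc j)) * (a j * (sgn (toℕ i) * (b i * M i j)))) ⟩
    ∑ℤ (λ i → ∑ℤ (λ j → sgn (toℕ (suc j)) * (a j * (sgn (toℕ i) * (b i * M i j)))))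
  ≡⟨ ∑-cong (λ i → ∑-cong (λ j → exchange (toℕ i) (toℕ j) (a j) (b i) (M i j))) ⟩
    ∑ℤ (λ i → ∑ℤ (λ j → sgn (toℕ (suc i)) * (b i * (sgn (toℕ j) * (a j * M i j)))))
  ≡⟨ ∑-cong (λ i → sym (pull (sgn (toℕ (suc i))) (b i) (λ j → sgn (toℕ j) * (a j * M i j)))) ⟩
    ∑ℤ (λ i → sgn (toℕ (suc i)) * (b i * ∑ℤ (λ j → sgn (toℕ j) * (a j * M i j))))
  ∎)
  where
  open ≡-Reasoning
  a b : Fin (suc n) → ℤ
  a j = A zero (suc j)
  b i = A (suc i) zero
  M : Fin (suc n) → Fin (suc n) → ℤ
  M i j = det (λ r k → A (suc (punchIn i r)) (suc (punchIn j k)))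
  pull : ∀ {m} (x y : ℤ) (f : Fin m → ℤ) → x * (y * ∑ℤ f) ≡ ∑ℤ (λ i → x * (y * f i))
  pull x y f = trans (cong (x *_) (sym (∑-*ˡ y f))) (sym (∑-*ˡ x (λ i → y * f i)))
  exchange : ∀ i j x y m → sgn (suc j) * (x * (sgn i * (y * m))) ≡ sgn (suc i) * (y * (sgn j * (x * m)))
  exchange i j x y m rewrite sgn-suc i | sgn-suc j = swap (sgn i) (sgn j) x y m
    where
    swap : ∀ s t x y m → - t * (x * (s * (y * m))) ≡ - s * (y * (t * (x * m)))
    swap = solve-∀

det-transpose : (A : Mat ℤ n) → det (transpose A) ≡ det A
det-transpose {zero} A = refl
det-transpose {suc n} A =
  trans (∑-cong (λ j → cong (λ m → sgn (toℕ j) * (A j zero * m)) (det-transpose (λ r k → A (punchIn j r) (suc k)))))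
        (sym (det-expand-col0 A))

det-+-row : (k : Fin n) {A B C : Mat ℤ n} → (∀ c → C k c ≡ A k c + B k c) →
  (∀ i → i ≢ k → ∀ c → B i c ≡ A i c) → (∀ i → i ≢ k → ∀ c → C i c ≡ A i c) → det C ≡ det A + det B
det-+-row {suc n} zero {A} {B} {C} Cₖ B≡A C≡A = begin
    det C
  ≡⟨ ∑-cong (λ j → cong₂ (λ x m → sgn (toℕ j) * (x * m)) (Cₖ j) (det-cong (λ i c → C≡A (suc i) (λ ()) (punchIn j c)))) ⟩
    ∑ℤ (λ j → sgn (toℕ j) * ((A zero j + B zero j) * det (minor j A)))
  ≡⟨ ∑-cong (λ j → distrib (sgn (toℕ j)) (A zero j) (B zero j) (det (minor j A))) ⟩
    ∑ℤ (λ j → sgn (toℕ j) * (A zero j * det (minor j A)) + sgn (toℕ j) * (B zero j * det (minor j A)))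
  ≡⟨ ∑-+ (λ j → sgn (toℕ j) * (A zero j * det (minor j A))) (λ j → sgn (toℕ j) * (B zero j * det (minor j A))) ⟩
    det A + ∑ℤ (λ j → sgn (toℕ j) * (B zero j * det (minor j A)))
  ≡⟨ cong (_+_ (det A)) (∑-cong (λ j → cong (λ m → sgn (toℕ j) * (B zero j * m))
                                          (det-cong (λ i c → sym (B≡A (suc i) (λ ()) (punchIn j c)))))) ⟩
    det A + det B
  ∎
  where
  open ≡-Reasoning
  distrib : ∀ s x y m → s * ((x + y) * m) ≡ s * (x * m) + s * (y * m)
  distrib = solve-∀
det-+-row {suc n} (suc k) {A} {B} {C} Cₖ B≡A C≡A = begin
    det C
  ≡⟨ ∑-cong (λ j → cong₂ (λ x m → sgn (toℕ j) * (x * m)) (C≡A zero (λ ()) j)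
       (det-+-row k (λ c → Cₖ (punchIn j c)) (λ i i≢k c → B≡A (suc i) (i≢k ∘ FinP.suc-injective) (punchIn j c))
                                              (λ i i≢k c → C≡A (suc i) (i≢k ∘ FinP.suc-injective) (punchIn j c)))) ⟩
    ∑ℤ (λ j → sgn (toℕ j) * (A zero j * (det (minor j A) + det (minor j B))))
  ≡⟨ ∑-cong (λ j → distrib (sgn (toℕ j)) (A zero j) (det (minor j A)) (det (minor j B))) ⟩
    ∑ℤ (λ j → sgn (toℕ j) * (A zero j * det (minor j A)) + sgn (toℕ j) * (A zero j * det (minor j B)))
  ≡⟨ ∑-+ (λ j → sgn (toℕ j) * (A zero j * det (minor j A))) (λ j → sgn (toℕ j) * (A zero j * det (minor j B))) ⟩
    det A + ∑ℤ (λ j → sgn (toℕ j) * (A zero j * det (minor j B)))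
  ≡⟨ cong (_+_ (det A)) (∑-cong (λ j → cong (λ x → sgn (toℕ j) * (x * det (minor j B))) (sym (B≡A zero (λ ()) j)))) ⟩
    det A + det B
  ∎
  where
  open ≡-Reasoning
  distrib : ∀ s x m m′ → s * (x * (m + m′)) ≡ s * (x * m) + s * (x * m′)
  distrib = solve-∀

det-equal-cols01 : (A : Mat ℤ (suc (suc n))) → (∀ i → A i zero ≡ A i (suc zero)) → det A ≡ + 0
det-equal-cols01-minor : (A : Mat ℤ (suc (suc n))) → (∀ i → A i zero ≡ A i (suc zero)) →
  (j : Fin n) → det (minor (suc (suc j)) A) ≡ + 0

det-equal-cols01 A col₀≡col₁ = begin
    sgn 0 * (A zero zero * det (minor zero A)) + (sgn 1 * (A zero (suc zero) * det (minor (suc zero) A)) + others)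
  ≡⟨ cong₂ (λ x m → sgn 0 * (x * m) + (sgn 1 * (A zero (suc zero) * det (minor (suc zero) A)) + others))
           (col₀≡col₁ zero) (det-cong minor₀≋minor₁) ⟩
    sgn 0 * t + (sgn 1 * t + others)
  ≡⟨ cong (λ s → sgn 0 * t + (sgn 1 * t + s)) (∑-zero (λ j →
       trans (cong (λ m → sgn (toℕ j) * (A zero (suc (suc j)) * m)) (det-equal-cols01-minor A col₀≡col₁ j))
             (trans (cong (sgn (toℕ j) *_) (ℤP.*-zeroʳ (A zero (suc (suc j))))) (ℤP.*-zeroʳ (sgn (toℕ j)))))) ⟩
    sgn 0 * t + (sgn 1 * t + + 0)
  ≡⟨ cancel t ⟩
    + 0
  ∎
  where
  open ≡-Reasoning
  others : ℤ
  others = ∑ℤ (λ j → sgn (toℕ j) * (A zero (suc (suc j)) * det (minor (suc (suc j)) A)))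
  t : ℤ
  t = A zero (suc zero) * det (minor (suc zero) A)
  minor₀≋minor₁ : minor zero A ≋ minor (suc zero) A
  minor₀≋minor₁ i zero = sym (col₀≡col₁ (suc i))
  minor₀≋minor₁ i (suc k) = refl
  cancel : ∀ x → + 1 * x + (- + 1 * x + + 0) ≡ + 0
  cancel = solve-∀

det-equal-cols01-minor {suc n} A col₀≡col₁ j = det-equal-cols01 (minor (suc (suc j)) A) (λ i → col₀≡col₁ (suc i))

det-equal-rows01 : (A : Mat ℤ (suc (suc n))) → (∀ c → A zero c ≡ A (suc zero) c) → det A ≡ + 0
det-equal-rows01 A row₀≡row₁ = trans (sym (det-transpose A)) (det-equal-cols01 (transpose A) row₀≡row₁)

swap01 : Fin (suc (suc n)) → Fin (suc (suc n))
swap01 zero = suc zero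
swap01 (suc zero) = zero
swap01 (suc (suc i)) = suc (suc i)

withRows01 : (x y : Fin (suc (suc n)) → ℤ) → Mat ℤ (suc (suc n)) → Mat ℤ (suc (suc n))
withRows01 x y A zero = x
withRows01 x y A (suc zero) = y
withRows01 x y A (suc (suc i)) = A (suc (suc i))

-- Polarization: det is additive in rows 0 and 1 and vanishes when they agree, hence it is alternating in them.
det-swap01 : (A : Mat ℤ (suc (suc n))) → det (A ∘ swap01) ≡ - det A
det-swap01 {n} A = begin
    det (A ∘ swap01)   ≡⟨ det-cong swapped ⟩
    D y x              ≡⟨ sym (solve-from-sum (D x y) (D y x) polar) ⟩
    - D x y            ≡⟨ cong -_ (det-cong (λ i c → sym (unchanged i c))) ⟩
    - det A            ∎
  where
  open ≡-Reasoning
  Row : Set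
  Row = Fin (suc (suc n)) → ℤ
  x y : Row
  x = A zero
  y = A (suc zero)
  D : Row → Row → ℤ
  D u v = det (withRows01 u v A)
  _⊕_ : Row → Row → Row
  (u ⊕ v) c = u c + v c
  D-+ˡ : ∀ u u′ v → D (u ⊕ u′) v ≡ D u v + D u′ v
  D-+ˡ u u′ v = det-+-row zero (λ c → refl) (off {u} {u′}) (off {u} {u ⊕ u′})
    where
    off : ∀ {w w′} i → i ≢ zero → ∀ c → withRows01 w′ v A i c ≡ withRows01 w v A i c
    off zero 0≢0 c = ⊥-elim (0≢0 refl)
    off (suc zero) _ c = refl
    off (suc (suc i)) _ c = refl
  D-+ʳ : ∀ u v v′ → D u (v ⊕ v′) ≡ D u v + D u v′
  D-+ʳ u v v′ = det-+-row (suc zero) (λ c → refl) (off {v} {v′}) (off {v} {v ⊕ v′})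
    where
    off : ∀ {w w′} i → i ≢ suc zero → ∀ c → withRows01 u w′ A i c ≡ withRows01 u w A i c
    off zero _ c = refl
    off (suc zero) 1≢1 c = ⊥-elim (1≢1 refl)
    off (suc (suc i)) _ c = refl
  D-diag : ∀ u → D u u ≡ + 0
  D-diag u = det-equal-rows01 (withRows01 u u A) (λ c → refl)
  polar : D x y + D y x ≡ + 0
  polar = begin
      D x y + D y x                              ≡⟨ sym (drop-zeros (D x y) (D y x)) ⟩
      (+ 0 + D x y) + (D y x + + 0)              ≡⟨ sym (cong₂ (λ a b → (a + D x y) + (D y x + b)) (D-diag x) (D-diag y)) ⟩
      (D x x + D x y) + (D y x + D y y)          ≡⟨ sym (cong₂ _+_ (D-+ʳ x x y) (D-+ʳ y x y)) ⟩
      D x (x ⊕ y) + D y (x ⊕ y)                  ≡⟨ sym (D-+ˡ x y (x ⊕ y)) ⟩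
      D (x ⊕ y) (x ⊕ y)                          ≡⟨ D-diag (x ⊕ y) ⟩
      + 0                                        ∎
    where
    drop-zeros : ∀ a b → (+ 0 + a) + (b + + 0) ≡ a + b
    drop-zeros = solve-∀
  solve-from-sum : ∀ a b → a + b ≡ + 0 → - a ≡ b
  solve-from-sum a b a+b≡0 = trans (sym (ℤP.+-identityʳ (- a))) (trans (cong (λ s → - a + s) (sym a+b≡0)) (cancel a b))
    where
    cancel : ∀ a b → - a + (a + b) ≡ b
    cancel = solve-∀
  swapped : A ∘ swap01 ≋ withRows01 y x A
  swapped zero c = refl
  swapped (suc zero) c = refl
  swapped (suc (suc i)) c = refl
  unchanged : A ≋ withRows01 x y A
  unchanged zero c = refl
  unchanged (suc zero) c = refl
  unchanged (suc (suc i)) c = refl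

-- A ∘ toTop k is A with row k moved to the top; A ∘ toSecond k moves row k + 1 to position 1.
toTop : Fin (suc n) → Fin (suc n) → Fin (suc n)
toTop k zero = k
toTop k (suc r) = punchIn k r

toSecond : Fin (suc n) → Fin (suc (suc n)) → Fin (suc (suc n))
toSecond k zero = zero
toSecond k (suc r) = suc (toTop k r)

toTop-zero : (r : Fin (suc n)) → toTop zero r ≡ r
toTop-zero zero = refl
toTop-zero (suc r) = refl

toTop-suc : (k : Fin (suc n)) (r : Fin (suc (suc n))) → toTop (suc k) r ≡ toSecond k (swap01 r)
toTop-suc k zero = refl
toTop-suc k (suc zero) = refl
toTop-suc k (suc (suc r)) = refl

-- toTop (suc k) is swap01 followed by toSecond k, and the minors of A ∘ toSecond k are those of A rotated by toTop k.
det-toTop : (A : Mat ℤ (suc n)) (k : Fin (suc n)) → det (A ∘ toTop k) ≡ sgn (toℕ k) * det A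
det-toSecond : (A : Mat ℤ (suc (suc n))) (k : Fin (suc n)) → det (A ∘ toSecond k) ≡ sgn (toℕ k) * det A

det-toTop A zero = trans (det-cong (λ r c → cong (λ s → A s c) (toTop-zero r))) (sym (ℤP.*-identityˡ (det A)))
det-toTop {suc n} A (suc k) = begin
    det (A ∘ toTop (suc k))           ≡⟨ det-cong (λ r c → cong (λ s → A s c) (toTop-suc k r)) ⟩
    det (A ∘ toSecond k ∘ swap01)     ≡⟨ det-swap01 (A ∘ toSecond k) ⟩
    - det (A ∘ toSecond k)            ≡⟨ cong -_ (det-toSecond A k) ⟩
    - (sgn (toℕ k) * det A)           ≡⟨ ℤP.neg-distribˡ-* (sgn (toℕ k)) (det A) ⟩
    - sgn (toℕ k) * det A             ≡⟨ cong (_* det A) (sym (sgn-suc (toℕ k))) ⟩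
    sgn (suc (toℕ k)) * det A         ∎
  where open ≡-Reasoning

det-toSecond A k = begin
    ∑ℤ (λ j → sgn (toℕ j) * (A zero j * det (minor j A ∘ toTop k)))
  ≡⟨ ∑-cong (λ j → cong (λ m → sgn (toℕ j) * (A zero j * m)) (det-toTop (minor j A) k)) ⟩
    ∑ℤ (λ j → sgn (toℕ j) * (A zero j * (sgn (toℕ k) * det (minor j A))))
  ≡⟨ ∑-cong (λ j → pull-out (sgn (toℕ j)) (A zero j) (sgn (toℕ k)) (det (minor j A))) ⟩
    ∑ℤ (λ j → sgn (toℕ k) * (sgn (toℕ j) * (A zero j * det (minor j A))))
  ≡⟨ ∑-*ˡ (sgn (toℕ k)) (λ j → sgn (toℕ j) * (A zero j * det (minor j A))) ⟩
    sgn (toℕ k) * det A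
  ∎
  where
  open ≡-Reasoning
  pull-out : ∀ s x t m → s * (x * (t * m)) ≡ t * (s * (x * m))
  pull-out = solve-∀

det-via-toTop : (A : Mat ℤ (suc n)) (k : Fin (suc n)) → det A ≡ sgn (toℕ k) * det (A ∘ toTop k)
det-via-toTop A k = trans (sym (sgn-involutive (toℕ k) (det A))) (cong (sgn (toℕ k) *_) (sym (det-toTop A k)))

cofactor : Mat ℤ (suc n) → Fin (suc n) → Fin (suc n) → ℤ
cofactor A k j = sgn (toℕ k) * (sgn (toℕ j) * det (minor j (A ∘ toTop k)))

det-expand-row : (A : Mat ℤ (suc n)) (k : Fin (suc n)) → det A ≡ ∑ℤ (λ j → A k j * cofactor A k j)
det-expand-row A k = begin
    det A
  ≡⟨ det-via-toTop A k ⟩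
    sgn (toℕ k) * det (A ∘ toTop k)
  ≡⟨ sym (∑-*ˡ (sgn (toℕ k)) (λ j → sgn (toℕ j) * (A k j * det (minor j (A ∘ toTop k))))) ⟩
    ∑ℤ (λ j → sgn (toℕ k) * (sgn (toℕ j) * (A k j * det (minor j (A ∘ toTop k)))))
  ≡⟨ ∑-cong (λ j → pull-in (sgn (toℕ k)) (sgn (toℕ j)) (A k j) (det (minor j (A ∘ toTop k)))) ⟩
    ∑ℤ (λ j → A k j * cofactor A k j)
  ∎
  where
  open ≡-Reasoning
  pull-in : ∀ s t x m → s * (t * (x * m)) ≡ x * (s * (t * m))
  pull-in = solve-∀

cofactor-cong : {A B : Mat ℤ (suc n)} (k : Fin (suc n)) → (∀ i → i ≢ k → ∀ c → A i c ≡ B i c) →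
  ∀ j → cofactor A k j ≡ cofactor B k j
cofactor-cong k agree j =
  cong (λ m → sgn (toℕ k) * (sgn (toℕ j) * m))
       (det-cong (λ i c → agree (punchIn k i) (FinP.punchInᵢ≢i k i) (punchIn j c)))

cofactor-transpose : (A : Mat ℤ (suc n)) (k j : Fin (suc n)) → cofactor (transpose A) k j ≡ cofactor A j k
cofactor-transpose A k j =
  trans (cong (λ m → sgn (toℕ k) * (sgn (toℕ j) * m)) (det-transpose (minor k (A ∘ toTop j))))
        (exchange (sgn (toℕ k)) (sgn (toℕ j)) (det (minor k (A ∘ toTop j))))
  where
  exchange : ∀ s t m → s * (t * m) ≡ t * (s * m)
  exchange = solve-∀

det-equal-row0 : (A : Mat ℤ (suc (suc n))) (r : Fin (suc n)) → (∀ c → A zero c ≡ A (suc r) c) → det A ≡ + 0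
det-equal-row0 A r same = begin
    det A                                 ≡⟨ sym (sgn-involutive (toℕ r) (det A)) ⟩
    sgn (toℕ r) * (sgn (toℕ r) * det A)   ≡⟨ cong (sgn (toℕ r) *_) (sym (det-toSecond A r)) ⟩
    sgn (toℕ r) * det (A ∘ toSecond r)    ≡⟨ cong (sgn (toℕ r) *_) (det-equal-rows01 (A ∘ toSecond r) same) ⟩
    sgn (toℕ r) * + 0                     ≡⟨ ℤP.*-zeroʳ (sgn (toℕ r)) ⟩
    + 0                                   ∎
  where open ≡-Reasoning

det-equal-rows : (A : Mat ℤ n) {a b : Fin n} → a ≢ b → (∀ c → A a c ≡ A b c) → det A ≡ + 0
det-equal-rows {suc zero} A {zero} {zero} a≢b _ = ⊥-elim (a≢b refl)
det-equal-rows {suc (suc n)} A {a} {b} a≢b same = begin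
    det A                               ≡⟨ det-via-toTop A a ⟩
    sgn (toℕ a) * det (A ∘ toTop a)     ≡⟨ cong (sgn (toℕ a) *_) (det-equal-row0 (A ∘ toTop a) (punchOut a≢b) same′) ⟩
    sgn (toℕ a) * + 0                   ≡⟨ ℤP.*-zeroʳ (sgn (toℕ a)) ⟩
    + 0                                 ∎
  where
  open ≡-Reasoning
  same′ : ∀ c → A a c ≡ A (punchIn a (punchOut a≢b)) c
  same′ c = trans (same c) (cong (λ s → A s c) (sym (FinP.punchIn-punchOut a≢b)))

setRow : Fin n → (Fin n → ℤ) → Mat ℤ n → Mat ℤ n
setRow k v A i with i Fin.≟ k
... | yes _ = v
... | no _ = A i

setRow-same : (k : Fin n) (v : Fin n → ℤ) (A : Mat ℤ n) → setRow k v A k ≡ v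
setRow-same k v A with k Fin.≟ k
... | yes _ = refl
... | no k≢k = ⊥-elim (k≢k refl)

setRow-other : {i k : Fin n} (v : Fin n → ℤ) (A : Mat ℤ n) → i ≢ k → setRow k v A i ≡ A i
setRow-other {i = i} {k} v A i≢k with i Fin.≟ k
... | yes i≡k = ⊥-elim (i≢k i≡k)
... | no _ = refl

setRow-id : (k : Fin n) (A : Mat ℤ n) → setRow k (A k) A ≋ A
setRow-id k A i c with i Fin.≟ k
... | yes refl = refl
... | no _ = refl

adj : Mat ℤ (suc n) → Mat ℤ (suc n)
adj A j k = cofactor A k j

det-setRow : (A : Mat ℤ (suc n)) (k : Fin (suc n)) (v : Fin (suc n) → ℤ) → det (setRow k v A) ≡ (v ᵀ· adj A) k
det-setRow A k v =
  trans (det-expand-row (setRow k v A) k)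
        (∑-cong (λ j → cong₂ _*_ (cong (λ r → r j) (setRow-same k v A))
                                 (cofactor-cong k (λ i i≢k c → cong (λ r → r c) (setRow-other v A i≢k)) j)))

*-adj : (A : Mat ℤ (suc n)) → A *ℤ adj A ≋ det A • idℤ
*-adj A i k = by-cases (i Fin.≟ k)
  where
  open ≡-Reasoning
  by-cases : Dec (i ≡ k) → (A i ᵀ· adj A) k ≡ det A * idℤ i k
  by-cases (yes refl) = begin
      (A i ᵀ· adj A) i       ≡⟨ sym (det-setRow A i (A i)) ⟩
      det (setRow i (A i) A) ≡⟨ det-cong (setRow-id i A) ⟩
      det A                  ≡⟨ sym (ℤP.*-identityʳ (det A)) ⟩
      det A * + 1            ≡⟨ cong (det A *_) (sym (diagℤ-diag _ i)) ⟩
      det A * idℤ i i        ∎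
  by-cases (no i≢k) = begin
      (A i ᵀ· adj A) k       ≡⟨ sym (det-setRow A k (A i)) ⟩
      det (setRow k (A i) A) ≡⟨ det-equal-rows (setRow k (A i) A) i≢k rows-agree ⟩
      + 0                    ≡⟨ sym (ℤP.*-zeroʳ (det A)) ⟩
      det A * + 0            ≡⟨ cong (det A *_) (sym (diagℤ-off _ i≢k)) ⟩
      det A * idℤ i k        ∎
    where
    rows-agree : ∀ c → setRow k (A i) A i c ≡ setRow k (A i) A k c
    rows-agree c = cong (λ r → r c) (trans (setRow-other (A i) A i≢k) (sym (setRow-same k (A i) A)))

adj-* : (A : Mat ℤ (suc n)) → adj A *ℤ A ≋ det A • idℤ
adj-* A i k = begin
    ∑ℤ (λ j → cofactor A j i * A j k)
  ≡⟨ ∑-cong (λ j → trans (ℤP.*-comm (cofactor A j i) (A j k)) (cong (A j k *_) (sym (cofactor-transpose A i j)))) ⟩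
    (transpose A *ℤ adj (transpose A)) k i
  ≡⟨ *-adj (transpose A) k i ⟩
    det (transpose A) * idℤ k i
  ≡⟨ cong₂ _*_ (det-transpose A) (idℤ-sym k i) ⟩
    det A * idℤ i k
  ∎
  where open ≡-Reasoning

unimodular⇒invertible : (U : Mat ℤ (suc n)) → Unimodular U →
  Σ (Mat ℤ (suc n)) (λ U⁻¹ → U⁻¹ *ℤ U ≋ idℤ × U *ℤ U⁻¹ ≋ idℤ)
unimodular⇒invertible U ∣detU∣≡1 = det U • adj U , left , right
  where
  unit² : ∀ {x} → ℤ.∣ x ∣ ≡ 1 → x * x ≡ + 1
  unit² {+ 1} refl = refl
  unit² { -[1+ 0 ]} refl = refl
  cancel : ∀ i j → det U * (det U * idℤ i j) ≡ idℤ i j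
  cancel i j = trans (sym (ℤP.*-assoc (det U) (det U) (idℤ i j)))
                     (trans (cong (_* idℤ i j) (unit² {det U} ∣detU∣≡1)) (ℤP.*-identityˡ (idℤ i j)))
  left : (det U • adj U) *ℤ U ≋ idℤ
  left i j = trans (•-*ˡ (det U) (adj U) U i j) (trans (cong (det U *_) (adj-* U i j)) (cancel i j))
  right : U *ℤ (det U • adj U) ≋ idℤ
  right i j = trans (•-*ʳ (det U) U (adj U) i j) (trans (cong (det U *_) (*-adj U i j)) (cancel i j))

ᵀ·-adj : (u : Fin (suc n) → ℤ) (A : Mat ℤ (suc n)) (k : Fin (suc n)) → (u ᵀ· A ᵀ· adj A) k ≡ u k * det A
ᵀ·-adj u A k = begin
    (u ᵀ· A ᵀ· adj A) k                  ≡⟨ ᵀ·-assoc u A (adj A) k ⟩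
    ∑ℤ (λ t → u t * (A *ℤ adj A) t k)     ≡⟨ ∑-cong (λ t → cong (u t *_) (*-adj A t k)) ⟩
    ∑ℤ (λ t → u t * (det A * idℤ t k))    ≡⟨ ∑-cong (λ t → sym (ℤP.*-assoc (u t) (det A) (idℤ t k))) ⟩
    ∑ℤ (λ t → u t * det A * idℤ t k)      ≡⟨ ∑-idℤʳ k (λ t → u t * det A) ⟩
    u k * det A                           ∎
  where open ≡-Reasoning

-- Divisibility by primes

prime∣* : ∀ {p a b} → Prime p → + p ℤS.∣ a * b → + p ℤS.∣ a ⊎ + p ℤS.∣ b
prime∣* {p} {a} {b} prime-p p∣ab with euclidsLemma ℤ.∣ a ∣ ℤ.∣ b ∣ prime-p (subst (p ℕD.∣_) (ℤP.abs-* a b) (∣⇒∣ᵤ p∣ab))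
... | inj₁ p∣a = inj₁ (∣ᵤ⇒∣ p∣a)
... | inj₂ p∣b = inj₂ (∣ᵤ⇒∣ p∣b)

prime∤1 : ∀ {p} → Prime p → ¬ (+ p ℤS.∣ + 1)
prime∤1 prime-p p∣1 = ¬prime[1] (subst Prime (ℕD.∣1⇒≡1 (∣⇒∣ᵤ p∣1)) prime-p)

prime²∣-cancelˡℕ : ∀ {p a b} → Prime p → ¬ (p ℕD.∣ a) → p ℕ.* p ℕD.∣ a ℕ.* b → p ℕ.* p ℕD.∣ b
prime²∣-cancelˡℕ {p} {a} {b} prime-p p∤a p²∣ab with euclidsLemma a b prime-p (ℕD.∣-trans (ℕD.m∣m*n p) p²∣ab)
... | inj₁ p∣a = ⊥-elim (p∤a p∣a)
... | inj₂ (ℕD.divides b′ refl) = [ ⊥-elim ∘ p∤a , ℕD.*-monoˡ-∣ p ]′ (euclidsLemma a b′ prime-p p∣ab′)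
  where
  instance
    p≢0 : ℕ.NonZero p
    p≢0 = prime⇒nonZero prime-p
  p∣ab′ : p ℕD.∣ a ℕ.* b′
  p∣ab′ = ℕD.*-cancelʳ-∣ p (subst (p ℕ.* p ℕD.∣_) (sym (ℕP.*-assoc a b′ p)) p²∣ab)

prime²∣-cancelˡ : ∀ {p a b} → Prime p → ¬ (+ p ℤS.∣ a) → + (p ℕ.* p) ℤS.∣ a * b → + (p ℕ.* p) ℤS.∣ b
prime²∣-cancelˡ {p} {a} {b} prime-p p∤a p²∣ab =
  ∣ᵤ⇒∣ (prime²∣-cancelˡℕ prime-p (p∤a ∘ ∣ᵤ⇒∣) (subst (p ℕ.* p ℕD.∣_) (ℤP.abs-* a b) (∣⇒∣ᵤ p²∣ab)))

∣∧∣⇒²∣* : ∀ {p a b} → + p ℤS.∣ a → + p ℤS.∣ b → + (p ℕ.* p) ℤS.∣ a * b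
∣∧∣⇒²∣* {p} {a} {b} p∣a p∣b =
  ∣ᵤ⇒∣ (subst (p ℕ.* p ℕD.∣_) (sym (ℤP.abs-* a b)) (ℕD.*-pres-∣ (∣⇒∣ᵤ p∣a) (∣⇒∣ᵤ p∣b)))

odd-prime∤2^ : ∀ {p} → Prime p → p ≢ 2 → ∀ k → ¬ (p ℕD.∣ 2 ℕ.^ k)
odd-prime∤2^ prime-p p≢2 zero p∣1 = ¬prime[1] (subst Prime (ℕD.∣1⇒≡1 p∣1) prime-p)
odd-prime∤2^ prime-p p≢2 (suc k) p∣2^k+1 with euclidsLemma 2 (2 ℕ.^ k) prime-p p∣2^k+1
... | inj₂ p∣2^k = odd-prime∤2^ prime-p p≢2 k p∣2^k
... | inj₁ p∣2 with irreducible[2] p∣2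
...   | inj₁ p≡1 = ¬prime[1] (subst Prime p≡1 prime-p)
...   | inj₂ p≡2 = p≢2 p≡2

odd-prime²∤2^*squarefree : ∀ {p} → Prime p → p ≢ 2 → ∀ k m → SquareFree m → ¬ (+ (p ℕ.* p) ℤS.∣ + (2 ℕ.^ k) * m)
odd-prime²∤2^*squarefree {p} prime-p p≢2 k m squarefree p²∣2^km =
  ¬prime[1] (subst Prime (squarefree p (∣⇒∣ᵤ p²∣m)) prime-p)
  where
  p²∣m : + (p ℕ.* p) ℤS.∣ m
  p²∣m = prime²∣-cancelˡ {a = + (2 ℕ.^ k)} prime-p (odd-prime∤2^ prime-p p≢2 k ∘ ∣⇒∣ᵤ) p²∣2^km

-- Left kernels modulo a prime

∣ᵀ·⇒∣*det : ∀ {q} (u : Fin (suc n) → ℤ) (A : Mat ℤ (suc n)) → (∀ c → q ℤS.∣ (u ᵀ· A) c) →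
  ∀ k → q ℤS.∣ u k * det A
∣ᵀ·⇒∣*det u A q∣uA k = subst (_ ℤS.∣_) (ᵀ·-adj u A k) (∑-∣ (λ c → ℤS.∣m⇒∣m*n (adj A c k) (q∣uA c)))

-- Dividing row j of A by q after replacing it by xᵀA gives a matrix M with x_j det A = q det M, and M still
-- annihilates y modulo q because y_j = 0; this produces the second factor q.
∣ᵀ·-pair⇒∣²*det : ∀ {q} (x y : Fin (suc n) → ℤ) (A : Mat ℤ (suc n)) {j : Fin (suc n)} →
  (∀ c → q ℤS.∣ (x ᵀ· A) c) → (∀ c → q ℤS.∣ (y ᵀ· A) c) → y j ≡ + 0 →
  ∀ k → q * q ℤS.∣ y k * (x j * det A)
∣ᵀ·-pair⇒∣²*det {n} {q} x y A {j} q∣xA q∣yA yⱼ≡0 k = conclude (∣ᵀ·⇒∣*det y M q∣yM k)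
  where
  open ≡-Reasoning
  rearrange : ∀ a b c → a * (b * c) ≡ b * (a * c)
  rearrange = solve-∀
  r : Fin (suc n) → ℤ
  r c = quotient (q∣xA c)
  M : Mat ℤ (suc n)
  M = setRow j r A
  xⱼdetA≡qdetM : x j * det A ≡ q * det M
  xⱼdetA≡qdetM = begin
      x j * det A                             ≡⟨ sym (ᵀ·-adj x A j) ⟩
      ∑ℤ (λ c → (x ᵀ· A) c * adj A c j)       ≡⟨ ∑-cong (λ c → cong (_* adj A c j) (ℤS._∣_.equality (q∣xA c))) ⟩
      ∑ℤ (λ c → r c * q * adj A c j)          ≡⟨ ∑-cong (λ c → pull (r c) q (adj A c j)) ⟩
      ∑ℤ (λ c → q * (r c * adj A c j))        ≡⟨ ∑-*ˡ q (λ c → r c * adj A c j) ⟩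
      q * (r ᵀ· adj A) j                      ≡⟨ cong (q *_) (sym (det-setRow A j r)) ⟩
      q * det M                               ∎
    where
    pull : ∀ a b c → a * b * c ≡ b * (a * c)
    pull = solve-∀
  q∣yM : ∀ c → q ℤS.∣ (y ᵀ· M) c
  q∣yM c = subst (q ℤS.∣_) (∑-cong (λ t → sym (same-terms t (t Fin.≟ j)))) (q∣yA c)
    where
    same-terms : ∀ t → Dec (t ≡ j) → y t * M t c ≡ y t * A t c
    same-terms t (yes refl) = trans (cong (_* M t c) yⱼ≡0) (sym (cong (_* A t c) yⱼ≡0))
    same-terms t (no t≢j) = cong (λ row → y t * row c) (setRow-other r A t≢j)
  conclude : q ℤS.∣ y k * det M → q * q ℤS.∣ y k * (x j * det A)
  conclude (divides t yₖdetM≡tq) = divides t (begin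
      y k * (x j * det A)     ≡⟨ cong (y k *_) xⱼdetA≡qdetM ⟩
      y k * (q * det M)       ≡⟨ rearrange (y k) q (det M) ⟩
      q * (y k * det M)       ≡⟨ cong (q *_) yₖdetM≡tq ⟩
      q * (t * q)             ≡⟨ rearrange q t q ⟩
      t * (q * q)             ∎)

-- Eliminating x_j from y gives a kernel vector y′ with y′_j = 0 and some y′_k prime to p.
independent-kernel⇒p²∣det : ∀ {p} → Prime p → (x y : Fin (suc n) → ℤ) (A : Mat ℤ (suc n)) →
  (∀ c → + p ℤS.∣ (x ᵀ· A) c) → (∀ c → + p ℤS.∣ (y ᵀ· A) c) →
  (∀ a b → (∀ i → + p ℤS.∣ a * x i + b * y i) → + p ℤS.∣ a × + p ℤS.∣ b) →
  + (p ℕ.* p) ℤS.∣ det A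
independent-kernel⇒p²∣det {n} {p} prime-p x y A p∣xA p∣yA independent =
  prime²∣-cancelˡ prime-p p∤xⱼ (prime²∣-cancelˡ prime-p p∤y′ₖ p²∣y′ₖxⱼdetA)
  where
  x≢0 : ¬ (∀ i → + p ℤS.∣ x i)
  x≢0 p∣x = prime∤1 prime-p (proj₁ (independent (+ 1) (+ 0) (λ i → subst (+ p ℤS.∣_) (sym (only-x (x i) (y i))) (p∣x i))))
    where
    only-x : ∀ a b → + 1 * a + + 0 * b ≡ a
    only-x = solve-∀
  j : Fin (suc n)
  j = proj₁ (FinP.¬∀⟶∃¬ (suc n) _ (λ i → + p ℤS.∣? x i) x≢0)
  p∤xⱼ : ¬ (+ p ℤS.∣ x j)
  p∤xⱼ = proj₂ (FinP.¬∀⟶∃¬ (suc n) _ (λ i → + p ℤS.∣? x i) x≢0)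
  y′ : Fin (suc n) → ℤ
  y′ t = x j * y t + - y j * x t
  y′ⱼ≡0 : y′ j ≡ + 0
  y′ⱼ≡0 = cancel (x j) (y j)
    where
    cancel : ∀ a b → a * b + - b * a ≡ + 0
    cancel = solve-∀
  p∣y′A : ∀ c → + p ℤS.∣ (y′ ᵀ· A) c
  p∣y′A c = subst (+ p ℤS.∣_) (sym (ᵀ·-lincomb (x j) (- y j) y x A c))
                  (ℤS.∣m∣n⇒∣m+n (ℤS.∣n⇒∣m*n (x j) (p∣yA c)) (ℤS.∣n⇒∣m*n (- y j) (p∣xA c)))
  y′≢0 : ¬ (∀ t → + p ℤS.∣ y′ t)
  y′≢0 p∣y′ = p∤xⱼ (proj₂ (independent (- y j) (x j) (λ i → subst (+ p ℤS.∣_) (ℤP.+-comm (x j * y i) (- y j * x i)) (p∣y′ i))))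
  k : Fin (suc n)
  k = proj₁ (FinP.¬∀⟶∃¬ (suc n) _ (λ t → + p ℤS.∣? y′ t) y′≢0)
  p∤y′ₖ : ¬ (+ p ℤS.∣ y′ k)
  p∤y′ₖ = proj₂ (FinP.¬∀⟶∃¬ (suc n) _ (λ t → + p ℤS.∣? y′ t) y′≢0)
  p²∣y′ₖxⱼdetA : + (p ℕ.* p) ℤS.∣ y′ k * (x j * det A)
  p²∣y′ₖxⱼdetA = subst (ℤS._∣ y′ k * (x j * det A)) (sym (ℤP.pos-* p p)) (∣ᵀ·-pair⇒∣²*det x y′ A p∣xA p∣y′A y′ⱼ≡0 k)

NonZeroMod : ℕ → Mat ℤ n → Set
NonZeroMod {n} p M = Σ (Fin n) λ i → Σ (Fin n) λ j → ¬ (+ p ℤS.∣ M i j)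

rankMod≡1 : ∀ {p} → Prime p → (M A : Mat ℤ (suc n)) → NonZeroMod p M →
  (∀ l c → + p ℤS.∣ (transpose M *ℤ A) l c) → ¬ (+ (p ℕ.* p) ℤS.∣ det A) → HasRankMod p M 1
rankMod≡1 {n} {p} prime-p M A (i , j , p∤Mᵢⱼ) p∣MᵀA p²∤detA = ((λ _ → j) , injective , independent) , dependent
  where
  injective : Injective _≡_ _≡_ (λ (_ : Fin 1) → j)
  injective {zero} {zero} _ = refl
  independent : IndependentColsMod p M (λ _ → j)
  independent a p∣aM zero = [ ∣⇒∣ᵤ , ⊥-elim ∘ p∤Mᵢⱼ ]′
    (prime∣* {a = a zero} prime-p (subst (+ p ℤS.∣_) (ℤP.+-identityʳ (a zero * M i j)) (∣ᵤ⇒∣ (p∣aM i))))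
  dependent : ∀ g → Injective _≡_ _≡_ g → ¬ IndependentColsMod p M g
  dependent g _ g-independent = p²∤detA (independent-kernel⇒p²∣det prime-p x y A (p∣MᵀA (g zero)) (p∣MᵀA (g (suc zero))) pair)
    where
    x y : Fin (suc n) → ℤ
    x t = M t (g zero)
    y t = M t (g (suc zero))
    pair : ∀ a b → (∀ l → + p ℤS.∣ a * x l + b * y l) → + p ℤS.∣ a × + p ℤS.∣ b
    pair a b p∣ax+by = ∣ᵤ⇒∣ (p∣coeff zero) , ∣ᵤ⇒∣ (p∣coeff (suc zero))
      where
      coeff : Fin 2 → ℤ
      coeff zero = a
      coeff (suc zero) = b
      p∣coeff = g-independent coeff (λ l → ∣⇒∣ᵤ (subst (+ p ℤS.∣_)
                  (cong (_+_ (a * x l)) (sym (ℤP.+-identityʳ (b * y l)))) (p∣ax+by l)))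

-- Smith normal form

module SmithForm (W U V : Mat ℤ n) (δ : Fin n → ℕ) (smith : (U *ℤ W) *ℤ V ≋ diagℤ δ) where

  -- This is the integrality of d W⁻¹ = V (d Δ⁻¹) U.
  ∣*W⇒∣d* : (U⁻¹ Y Z : Mat ℤ n) {d : ℕ} {ℓ : ℤ} → U⁻¹ *ℤ U ≋ idℤ → (∀ b → δ b ℕD.∣ d) → Y *ℤ W ≋ ℓ • Z →
    ∀ i j → ℓ ℤS.∣ + d * Y i j
  ∣*W⇒∣d* U⁻¹ Y Z {d} {ℓ} U⁻¹U≋I δ∣d YW≋ℓZ i j =
    subst (ℓ ℤS.∣_) dXU≡dY (∑-∣ (λ b → ℤS.∣m⇒∣m*n (U b j) (ℓ∣dX i b)))
    where
    open ≡-Reasoning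
    X : Mat ℤ n
    X = Y *ℤ U⁻¹
    XU≋Y : X *ℤ U ≋ Y
    XU≋Y a b = trans (*-assoc Y U⁻¹ U a b) (trans (*-congʳ Y U⁻¹U≋I a b) (*-identityʳ Y a b))
    XΔ : ∀ a b → X a b * + δ b ≡ ℓ * (Z *ℤ V) a b
    XΔ a b = begin
        X a b * + δ b                 ≡⟨ sym (*-diagℤ X δ a b) ⟩
        (X *ℤ diagℤ δ) a b            ≡⟨ *-congʳ X (λ r c → sym (smith r c)) a b ⟩
        (X *ℤ ((U *ℤ W) *ℤ V)) a b    ≡⟨ sym (*-assoc X (U *ℤ W) V a b) ⟩
        ((X *ℤ (U *ℤ W)) *ℤ V) a b    ≡⟨ *-congˡ V (λ r c → trans (sym (*-assoc X U W r c)) (*-congˡ W XU≋Y r c)) a b ⟩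
        ((Y *ℤ W) *ℤ V) a b           ≡⟨ *-congˡ V YW≋ℓZ a b ⟩
        ((ℓ • Z) *ℤ V) a b            ≡⟨ •-*ˡ ℓ Z V a b ⟩
        ℓ * (Z *ℤ V) a b              ∎
    ℓ∣dX : ∀ a b → ℓ ℤS.∣ + d * X a b
    ℓ∣dX a b with δ∣d b
    ... | ℕD.divides t d≡tδ = divides (+ t * (Z *ℤ V) a b) (begin
        + d * X a b                  ≡⟨ cong (λ e → + e * X a b) d≡tδ ⟩
        + (t ℕ.* δ b) * X a b        ≡⟨ cong (_* X a b) (ℤP.pos-* t (δ b)) ⟩
        + t * + δ b * X a b          ≡⟨ regroup (+ t) (+ δ b) (X a b) ⟩
        + t * (X a b * + δ b)        ≡⟨ cong (+ t *_) (XΔ a b) ⟩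
        + t * (ℓ * (Z *ℤ V) a b)     ≡⟨ regroup′ (+ t) ℓ ((Z *ℤ V) a b) ⟩
        + t * (Z *ℤ V) a b * ℓ       ∎)
      where
      regroup : ∀ x y z → x * y * z ≡ x * (z * y)
      regroup = solve-∀
      regroup′ : ∀ x y z → x * (y * z) ≡ x * z * y
      regroup′ = solve-∀
    dXU≡dY : ∑ℤ (λ b → + d * X i b * U b j) ≡ + d * Y i j
    dXU≡dY = trans (∑-cong (λ b → ℤP.*-assoc (+ d) (X i b) (U b j)))
                   (trans (∑-*ˡ (+ d) (λ b → X i b * U b j)) (cong (+ d *_) (XU≋Y i j)))

  δ∣Uᵀ·W : (V⁻¹ : Mat ℤ n) → V *ℤ V⁻¹ ≋ idℤ → ∀ k c → + δ k ℤS.∣ (U k ᵀ· W) c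
  δ∣Uᵀ·W V⁻¹ VV⁻¹≋I k c = divides (V⁻¹ k c) (begin
      (U *ℤ W) k c                     ≡⟨ sym (*-identityʳ (U *ℤ W) k c) ⟩
      ((U *ℤ W) *ℤ idℤ) k c            ≡⟨ *-congʳ (U *ℤ W) (λ r s → sym (VV⁻¹≋I r s)) k c ⟩
      ((U *ℤ W) *ℤ (V *ℤ V⁻¹)) k c     ≡⟨ sym (*-assoc (U *ℤ W) V V⁻¹ k c) ⟩
      (((U *ℤ W) *ℤ V) *ℤ V⁻¹) k c     ≡⟨ *-congˡ V⁻¹ smith k c ⟩
      (diagℤ δ *ℤ V⁻¹) k c             ≡⟨ diagℤ-* δ V⁻¹ k c ⟩
      + δ k * V⁻¹ k c                  ≡⟨ ℤP.*-comm (+ δ k) (V⁻¹ k c) ⟩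
      V⁻¹ k c * + δ k                  ∎)
    where open ≡-Reasoning

unimodular⇒row-prime-entry : ∀ {p} → Prime p → (U : Mat ℤ (suc n)) → Unimodular U →
  ∀ k → ∃ λ j → ¬ (+ p ℤS.∣ U k j)
unimodular⇒row-prime-entry {n} {p} prime-p U ∣detU∣≡1 k = FinP.¬∀⟶∃¬ (suc n) _ (λ j → + p ℤS.∣? U k j) row≢0
  where
  row≢0 : ¬ (∀ j → + p ℤS.∣ U k j)
  row≢0 p∣row = prime∤1 prime-p (∣ᵤ⇒∣ (subst (p ℕD.∣_) ∣detU∣≡1 (∣⇒∣ᵤ p∣detU)))
    where
    p∣detU : + p ℤS.∣ det U
    p∣detU = subst (+ p ℤS.∣_) (sym (det-expand-row U k)) (∑-∣ (λ j → ℤS.∣m⇒∣m*n (cofactor U k j) (p∣row j)))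

smith-p²∣δ⇒p²∣det : ∀ {p} → Prime p → (W U V : Mat ℤ (suc n)) (δ : Fin (suc n) → ℕ) →
  (U *ℤ W) *ℤ V ≋ diagℤ δ → Unimodular U → Unimodular V →
  ∀ k → + (p ℕ.* p) ℤS.∣ + δ k → + (p ℕ.* p) ℤS.∣ det W
smith-p²∣δ⇒p²∣det {n} {p} prime-p W U V δ smith unimodU unimodV k p²∣δₖ =
  prime²∣-cancelˡ prime-p p∤Uₖⱼ (∣ᵀ·⇒∣*det (U k) W p²∣UₖW j)
  where
  j : Fin (suc n)
  j = proj₁ (unimodular⇒row-prime-entry prime-p U unimodU k)
  p∤Uₖⱼ : ¬ (+ p ℤS.∣ U k j)
  p∤Uₖⱼ = proj₂ (unimodular⇒row-prime-entry prime-p U unimodU k)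
  VV⁻¹≋I : V *ℤ (det V • adj V) ≋ idℤ
  VV⁻¹≋I = proj₂ (proj₂ (unimodular⇒invertible V unimodV))
  p²∣UₖW : ∀ c → + (p ℕ.* p) ℤS.∣ (U k ᵀ· W) c
  p²∣UₖW c = ℤS.∣-trans p²∣δₖ (SmithForm.δ∣Uᵀ·W W U V δ smith (det V • adj V) VV⁻¹≋I k c)

largestInvariantFactor-∣*W⇒∣d* : (W : Mat ℤ (suc n)) {d : ℕ} → IsLargestInvariantFactor W d →
  (Y Z : Mat ℤ (suc n)) {ℓ : ℤ} → Y *ℤ W ≋ ℓ • Z → ∀ i j → ℓ ℤS.∣ + d * Y i j
largestInvariantFactor-∣*W⇒∣d* {n} W (δ , ((U , V , unimodU , _ , smith) , _ , δ-chain) , d≡δₗₐₛₜ) Y Z =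
  SmithForm.∣*W⇒∣d* W U V δ smith (det U • adj U) Y Z (proj₁ (proj₂ (unimodular⇒invertible U unimodU))) δ∣d
  where
  δ∣d : ∀ b → δ b ℕD.∣ _
  δ∣d b = subst (δ b ℕD.∣_) (sym d≡δₗₐₛₜ) (δ-chain b (fromℕ n) (FinP.≤fromℕ b))

largestInvariantFactor-p²∣ : ∀ {p} → Prime p → (W : Mat ℤ (suc n)) {d : ℕ} → IsLargestInvariantFactor W d →
  + (p ℕ.* p) ℤS.∣ + d → + (p ℕ.* p) ℤS.∣ det W
largestInvariantFactor-p²∣ {n} prime-p W (δ , ((U , V , unimodU , unimodV , smith) , _) , d≡δₗₐₛₜ) p²∣d =
  smith-p²∣δ⇒p²∣det prime-p W U V δ smith unimodU unimodV (fromℕ n) (subst (λ e → _ ℤS.∣ + e) d≡δₗₐₛₜ p²∣d)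

-- Orthogonal integral matrices and walks

-- E = R Rᵀ − c I is symmetric, R Rᵀ R Rᵀ = c R Rᵀ gives E² = −c E, and tr E = tr (Rᵀ R) − c n = 0;
-- hence ∑ᵢⱼ Eᵢⱼ² = tr E² = −c tr E = 0.
RᵀR⇒RRᵀ : (R : Mat ℤ n) (c : ℤ) → transpose R *ℤ R ≋ c • idℤ → R *ℤ transpose R ≋ c • idℤ
RᵀR⇒RRᵀ {n} R c RᵀR≋cI i j = ℤP.i-j≡0⇒i≡j (P i j) (c * idℤ i j) (∑-squares≡0 E ∑∑E²≡0 i j)
  where
  open ≡-Reasoning
  Rᵀ : Mat ℤ n
  Rᵀ = transpose R
  P E : Mat ℤ n
  P = R *ℤ Rᵀ
  E a b = P a b - c * idℤ a b
  ∑-minus : (f g : Fin n → ℤ) → ∑ℤ (λ k → f k - c * g k) ≡ ∑ℤ f - c * ∑ℤ g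
  ∑-minus f g = trans (∑-+ f (λ k → - (c * g k)))
    (cong (_+_ (∑ℤ f)) (trans (∑-cong (λ k → ℤP.neg-distribˡ-* c (g k)))
                              (trans (∑-*ˡ (- c) g) (sym (ℤP.neg-distribˡ-* c (∑ℤ g))))))
  PP≋cP : P *ℤ P ≋ c • P
  PP≋cP a b = begin
      (P *ℤ P) a b                      ≡⟨ *-assoc R Rᵀ P a b ⟩
      (R *ℤ (Rᵀ *ℤ P)) a b              ≡⟨ *-congʳ R (λ r s → sym (*-assoc Rᵀ R Rᵀ r s)) a b ⟩
      (R *ℤ ((Rᵀ *ℤ R) *ℤ Rᵀ)) a b      ≡⟨ *-congʳ R (*-congˡ Rᵀ RᵀR≋cI) a b ⟩
      (R *ℤ ((c • idℤ) *ℤ Rᵀ)) a b      ≡⟨ *-congʳ R (λ r s → trans (•-*ˡ c idℤ Rᵀ r s) (cong (c *_) (*-identityˡ Rᵀ r s))) a b ⟩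
      (R *ℤ (c • Rᵀ)) a b               ≡⟨ •-*ʳ c R Rᵀ a b ⟩
      c * P a b                         ∎
  ∑-PE≡0 : ∀ a → ∑ℤ (λ b → P a b * E a b) ≡ + 0
  ∑-PE≡0 a = begin
      ∑ℤ (λ b → P a b * E a b)                         ≡⟨ ∑-cong (λ b → expand (P a b) c (idℤ a b)) ⟩
      ∑ℤ (λ b → P a b * P a b - c * (idℤ a b * P a b)) ≡⟨ ∑-minus (λ b → P a b * P a b) (λ b → idℤ a b * P a b) ⟩
      ∑ℤ (λ b → P a b * P a b) - c * ∑ℤ (λ b → idℤ a b * P a b)
        ≡⟨ cong₂ (λ x y → x - c * y) (trans (∑-cong (λ b → cong (P a b *_) (∑-cong (λ k → ℤP.*-comm (R a k) (R b k))))) (PP≋cP a a))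
                                     (∑-idℤˡ a (P a)) ⟩
      c * P a a - c * P a a                            ≡⟨ ℤP.+-inverseʳ (c * P a a) ⟩
      + 0                                              ∎
    where
    expand : ∀ x c d → x * (x - c * d) ≡ x * x - c * (d * x)
    expand = solve-∀
  trI : ℤ
  trI = ∑ℤ {n} (λ a → idℤ a a)
  trE≡0 : ∑ℤ (λ a → E a a) ≡ + 0
  trE≡0 = begin
      ∑ℤ (λ a → E a a)             ≡⟨ ∑-minus (λ a → P a a) (λ a → idℤ a a) ⟩
      ∑ℤ (λ a → P a a) - c * trI   ≡⟨ cong (_- c * trI) trP ⟩
      c * trI - c * trI            ≡⟨ ℤP.+-inverseʳ (c * trI) ⟩
      + 0                          ∎
    where
    trP : ∑ℤ (λ a → P a a) ≡ c * trI
    trP = trans (∑-comm (λ a k → R a k * R a k)) (trans (∑-cong (λ k → RᵀR≋cI k k)) (∑-*ˡ c (λ (a : Fin n) → idℤ a a)))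
  ∑∑E²≡0 : ∑ℤ (λ a → ∑ℤ (λ b → E a b * E a b)) ≡ + 0
  ∑∑E²≡0 = begin
      ∑ℤ (λ a → ∑ℤ (λ b → E a b * E a b))
    ≡⟨ ∑-cong (λ a → trans (∑-cong (λ b → expand (P a b) c (idℤ a b) (E a b)))
                           (trans (∑-minus (λ b → P a b * E a b) (λ b → idℤ a b * E a b))
                                  (cong₂ (λ x y → x - c * y) (∑-PE≡0 a) (∑-idℤˡ a (E a))))) ⟩
      ∑ℤ (λ a → + 0 - c * E a a)
    ≡⟨ ∑-minus (λ (_ : Fin n) → + 0) (λ a → E a a) ⟩
      ∑ℤ {n} (λ _ → + 0) - c * ∑ℤ (λ a → E a a)
    ≡⟨ cong₂ (λ x y → x - c * y) (∑-zero {n} (λ _ → refl)) trE≡0 ⟩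
      + 0 - c * + 0
    ≡⟨ cong (λ x → + 0 - x) (ℤP.*-zeroʳ c) ⟩
      + 0
    ∎
    where
    expand : ∀ x c d e → (x - c * d) * e ≡ x * e - c * (d * e)
    expand = solve-∀

RᵀSR⇒SR≋RT : (R S T : Mat ℤ n) (c : ℤ) .{{_ : ℤ.NonZero c}} →
  R *ℤ transpose R ≋ c • idℤ → transpose R *ℤ (S *ℤ R) ≋ c • T → S *ℤ R ≋ R *ℤ T
RᵀSR⇒SR≋RT R S T c RRᵀ≋cI RᵀSR≋cT = •-cancel c λ i j → begin
    c * (S *ℤ R) i j                          ≡⟨ cong (c *_) (sym (*-identityˡ (S *ℤ R) i j)) ⟩
    c * (idℤ *ℤ (S *ℤ R)) i j                 ≡⟨ sym (•-*ˡ c idℤ (S *ℤ R) i j) ⟩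
    ((c • idℤ) *ℤ (S *ℤ R)) i j               ≡⟨ *-congˡ (S *ℤ R) (λ a b → sym (RRᵀ≋cI a b)) i j ⟩
    ((R *ℤ transpose R) *ℤ (S *ℤ R)) i j      ≡⟨ *-assoc R (transpose R) (S *ℤ R) i j ⟩
    (R *ℤ (transpose R *ℤ (S *ℤ R))) i j      ≡⟨ *-congʳ R RᵀSR≋cT i j ⟩
    (R *ℤ (c • T)) i j                        ≡⟨ •-*ʳ c R T i j ⟩
    c * (R *ℤ T) i j                          ∎
  where open ≡-Reasoning

walkMatrix-intertwine : (D C : OrientedGraph n) (R : Mat ℤ n) (ℓ : ℤ) .{{_ : ℤ.NonZero ℓ}} →
  transpose R *ℤ R ≋ (ℓ * ℓ) • idℤ → (∀ i → (R ·ℤ ones) i ≡ ℓ) →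
  transpose R *ℤ (skew D *ℤ R) ≋ (ℓ * ℓ) • skew C → transpose R *ℤ walkMatrix D ≋ ℓ • walkMatrix C
walkMatrix-intertwine D C R ℓ RᵀR≋ℓ²I Re≡ℓ RᵀSR≋ℓ²T i j = ℤP.*-cancelˡ-≡ ℓ _ _ (begin
    ℓ * ∑ℤ (λ k → R k i * walkVec D (toℕ j) k)         ≡⟨ sym (∑-*ˡ ℓ (λ k → R k i * walkVec D (toℕ j) k)) ⟩
    ∑ℤ (λ k → ℓ * (R k i * walkVec D (toℕ j) k))       ≡⟨ ∑-cong (λ k → trans (swap ℓ (R k i) _) (cong (R k i *_) (walk (toℕ j) k))) ⟩
    (transpose R ·ℤ (R ·ℤ walkVec C (toℕ j))) i        ≡⟨ ·-assoc (transpose R) R (walkVec C (toℕ j)) i ⟩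
    ((transpose R *ℤ R) ·ℤ walkVec C (toℕ j)) i        ≡⟨ ∑-cong (λ k → cong (_* walkVec C (toℕ j) k) (RᵀR≋ℓ²I i k)) ⟩
    ∑ℤ (λ k → ℓ * ℓ * idℤ i k * walkVec C (toℕ j) k)   ≡⟨ ∑-cong (λ k → regroup (ℓ * ℓ) (idℤ i k) _) ⟩
    ∑ℤ (λ k → idℤ i k * (ℓ * ℓ * walkVec C (toℕ j) k)) ≡⟨ ∑-idℤˡ i (λ k → ℓ * ℓ * walkVec C (toℕ j) k) ⟩
    ℓ * ℓ * walkMatrix C i j                           ≡⟨ ℤP.*-assoc ℓ ℓ _ ⟩
    ℓ * (ℓ * walkMatrix C i j)                         ∎)
  where
  open ≡-Reasoning
  instance
    ℓ²≢0 : ℤ.NonZero (ℓ * ℓ)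
    ℓ²≢0 = ℤP.i*j≢0 ℓ ℓ
  swap : ∀ a b c → a * (b * c) ≡ b * (a * c)
  swap = solve-∀
  regroup : ∀ a b c → a * b * c ≡ b * (a * c)
  regroup = solve-∀
  SR≋RT : skew D *ℤ R ≋ R *ℤ skew C
  SR≋RT = RᵀSR⇒SR≋RT R (skew D) (skew C) (ℓ * ℓ) (RᵀR⇒RRᵀ R (ℓ * ℓ) RᵀR≋ℓ²I) RᵀSR≋ℓ²T
  walk : ∀ t k → ℓ * walkVec D t k ≡ (R ·ℤ walkVec C t) k
  walk zero k = trans (ℤP.*-identityʳ ℓ) (sym (Re≡ℓ k))
  walk (suc t) k = begin
      ℓ * ∑ℤ (λ a → skew D k a * walkVec D t a)     ≡⟨ sym (∑-*ˡ ℓ (λ a → skew D k a * walkVec D t a)) ⟩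
      ∑ℤ (λ a → ℓ * (skew D k a * walkVec D t a))   ≡⟨ ∑-cong (λ a → trans (swap ℓ (skew D k a) _) (cong (skew D k a *_) (walk t a))) ⟩
      (skew D ·ℤ (R ·ℤ walkVec C t)) k              ≡⟨ ·-assoc (skew D) R (walkVec C t) k ⟩
      ((skew D *ℤ R) ·ℤ walkVec C t) k              ≡⟨ ∑-cong (λ a → cong (_* walkVec C t a) (SR≋RT k a)) ⟩
      ((R *ℤ skew C) ·ℤ walkVec C t) k              ≡⟨ sym (·-assoc R (skew C) (walkVec C t) k) ⟩
      (R ·ℤ walkVec C (suc t)) k                    ∎

-- From rational to integral matrices

toℚ-injective : ∀ {a b} → toℚ a ≡ toℚ b → a ≡ b
toℚ-injective {a} {b} toℚa≡toℚb with ℚP.fromℚᵘ-injective {ℚᵘ.mkℚᵘ a 0} {ℚᵘ.mkℚᵘ b 0} toℚa≡toℚb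
... | ℚᵘ.*≡* a*1≡b*1 = trans (sym (ℤP.*-identityʳ a)) (trans a*1≡b*1 (ℤP.*-identityʳ b))

toℚᵘ-toℚ : ∀ a → ℚ.toℚᵘ (toℚ a) ℚᵘ.≃ ℚᵘ.mkℚᵘ a 0
toℚᵘ-toℚ a = ℚP.toℚᵘ-fromℚᵘ (ℚᵘ.mkℚᵘ a 0)

toℚ-+ : ∀ a b → toℚ (a + b) ≡ toℚ a ℚ.+ toℚ b
toℚ-+ a b = ℚP.toℚᵘ-injective (ℚᵘP.≃-trans (toℚᵘ-toℚ (a + b)) (ℚᵘP.≃-sym
  (ℚᵘP.≃-trans (ℚP.toℚᵘ-homo-+ (toℚ a) (toℚ b)) (ℚᵘP.≃-trans (ℚᵘP.+-cong (toℚᵘ-toℚ a) (toℚᵘ-toℚ b)) (ℚᵘ.*≡* (sum a b))))))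
  where
  sum : ∀ a b → (a * + 1 + b * + 1) * + 1 ≡ (a + b) * + 1
  sum = solve-∀

toℚ-* : ∀ a b → toℚ (a * b) ≡ toℚ a ℚ.* toℚ b
toℚ-* a b = ℚP.toℚᵘ-injective (ℚᵘP.≃-trans (toℚᵘ-toℚ (a * b)) (ℚᵘP.≃-sym
  (ℚᵘP.≃-trans (ℚP.toℚᵘ-homo-* (toℚ a) (toℚ b)) (ℚᵘP.*-cong (toℚᵘ-toℚ a) (toℚᵘ-toℚ b)))))

∑ℚ≡sum : (f : Fin n → ℚ) → ∑ℚ f ≡ ΣQ.sum f
∑ℚ≡sum {zero} f = refl
∑ℚ≡sum {suc n} f = cong (f zero ℚ.+_) (∑ℚ≡sum (f ∘ suc))

∑ℚ-cong : {f g : Fin n → ℚ} → (∀ i → f i ≡ g i) → ∑ℚ f ≡ ∑ℚ g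
∑ℚ-cong {f = f} {g} f≗g = trans (∑ℚ≡sum f) (trans (ΣQ.sum-cong-≗ f≗g) (sym (∑ℚ≡sum g)))

∑ℚ-*ˡ : (c : ℚ) (f : Fin n → ℚ) → ∑ℚ (λ i → c ℚ.* f i) ≡ c ℚ.* ∑ℚ f
∑ℚ-*ˡ c f = trans (∑ℚ≡sum (λ i → c ℚ.* f i)) (trans (sym (ΣQ.*-distribˡ-sum c f)) (cong (c ℚ.*_) (sym (∑ℚ≡sum f))))

toℚ-∑ : (f : Fin n → ℤ) → toℚ (∑ℤ f) ≡ ∑ℚ (λ i → toℚ (f i))
toℚ-∑ {zero} f = refl
toℚ-∑ {suc n} f = trans (toℚ-+ (f zero) _) (cong (toℚ (f zero) ℚ.+_) (toℚ-∑ (f ∘ suc)))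

toℚ-cancelˡ : ∀ m .{{_ : ℕ.NonZero m}} {x y : ℚ} → toℚ (+ m) ℚ.* x ≡ toℚ (+ m) ℚ.* y → x ≡ y
toℚ-cancelˡ (suc k) {x} {y} mx≡my = begin
    x                          ≡⟨ sym (ℚP.*-identityˡ x) ⟩
    ℚ.1ℚ ℚ.* x                 ≡⟨ cong (ℚ._* x) (sym (ℚP.*-inverseˡ m)) ⟩
    (ℚ.1/ m ℚ.* m) ℚ.* x       ≡⟨ ℚP.*-assoc (ℚ.1/ m) m x ⟩
    ℚ.1/ m ℚ.* (m ℚ.* x)       ≡⟨ cong (ℚ.1/ m ℚ.*_) (trans (cong (ℚ._* x) (sym toℚm≡m)) (trans mx≡my (cong (ℚ._* y) toℚm≡m))) ⟩
    ℚ.1/ m ℚ.* (m ℚ.* y)       ≡⟨ sym (ℚP.*-assoc (ℚ.1/ m) m y) ⟩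
    (ℚ.1/ m ℚ.* m) ℚ.* y       ≡⟨ cong (ℚ._* y) (ℚP.*-inverseˡ m) ⟩
    ℚ.1ℚ ℚ.* y                 ≡⟨ ℚP.*-identityˡ y ⟩
    y                          ∎
  where
  open ≡-Reasoning
  m : ℚ
  m = ℚ.mkℚ (+ suc k) 0 (Coprime.sym (Coprime.1-coprimeTo (suc k)))
  toℚm≡m : toℚ (+ suc k) ≡ m
  toℚm≡m = ℚP.↥p/↧p≡p m

toℚ-idℤ : (i j : Fin n) → toℚ (idℤ i j) ≡ idℚ i j
toℚ-idℤ i j with i Fin.≟ j
... | yes _ = refl
... | no _ = refl

toℚ-scaled-* : (A B : Mat ℤ n) (A′ B′ : Mat ℚ n) (a b : ℚ) →
  (∀ i k → toℚ (A i k) ≡ a ℚ.* A′ i k) → (∀ k j → toℚ (B k j) ≡ b ℚ.* B′ k j) →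
  ∀ i j → toℚ ((A *ℤ B) i j) ≡ (a ℚ.* b) ℚ.* (A′ *ℚ B′) i j
toℚ-scaled-* A B A′ B′ a b A≡aA′ B≡bB′ i j = begin
    toℚ (∑ℤ (λ k → A i k * B k j))                      ≡⟨ toℚ-∑ (λ k → A i k * B k j) ⟩
    ∑ℚ (λ k → toℚ (A i k * B k j))                      ≡⟨ ∑ℚ-cong (λ k → term k) ⟩
    ∑ℚ (λ k → (a ℚ.* b) ℚ.* (A′ i k ℚ.* B′ k j))        ≡⟨ ∑ℚ-*ˡ (a ℚ.* b) (λ k → A′ i k ℚ.* B′ k j) ⟩
    (a ℚ.* b) ℚ.* (A′ *ℚ B′) i j                        ∎
  where
  open ≡-Reasoning
  open ℚSolver
  term : ∀ k → toℚ (A i k * B k j) ≡ (a ℚ.* b) ℚ.* (A′ i k ℚ.* B′ k j)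
  term k = trans (toℚ-* (A i k) (B k j)) (trans (cong₂ ℚ._*_ (A≡aA′ i k) (B≡bB′ k j))
    (solve 4 (λ a b x y → (a :* x) :* (b :* y) := (a :* b) :* (x :* y)) refl a b (A′ i k) (B′ k j)))

module ScaledToIntegral (ℓ : ℕ) (Q : Mat ℚ n) (R : Mat ℤ n) (ℓQ≡R : ∀ i j → scaleℚ ℓ Q i j ≡ toℚ (R i j)) where

  private
    L : ℚ
    L = toℚ (+ ℓ)
    R≡LQ : ∀ i k → toℚ (R i k) ≡ L ℚ.* Q i k
    R≡LQ i k = sym (ℓQ≡R i k)
    Rᵀ≡LQᵀ : ∀ i k → toℚ (transpose R i k) ≡ L ℚ.* transpose Q i k
    Rᵀ≡LQᵀ i k = sym (ℓQ≡R k i)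
    toℚ-ℓ²* : ∀ x → toℚ (+ ℓ * + ℓ * x) ≡ (L ℚ.* L) ℚ.* toℚ x
    toℚ-ℓ²* x = trans (toℚ-* (+ ℓ * + ℓ) x) (cong (ℚ._* toℚ x) (toℚ-* (+ ℓ) (+ ℓ)))

  scaled-Gram : (∀ i j → (transpose Q *ℚ Q) i j ≡ idℚ i j) → transpose R *ℤ R ≋ (+ ℓ * + ℓ) • idℤ
  scaled-Gram QᵀQ≡I i j = toℚ-injective (begin
      toℚ ((transpose R *ℤ R) i j)           ≡⟨ toℚ-scaled-* (transpose R) R (transpose Q) Q L L Rᵀ≡LQᵀ R≡LQ i j ⟩
      (L ℚ.* L) ℚ.* (transpose Q *ℚ Q) i j   ≡⟨ cong ((L ℚ.* L) ℚ.*_) (trans (QᵀQ≡I i j) (sym (toℚ-idℤ i j))) ⟩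
      (L ℚ.* L) ℚ.* toℚ (idℤ i j)            ≡⟨ sym (toℚ-ℓ²* (idℤ i j)) ⟩
      toℚ (+ ℓ * + ℓ * idℤ i j)              ∎)
    where open ≡-Reasoning

  scaled-walkMatrix : (D C : OrientedGraph n) .{{_ : ℕ.NonZero ℓ}} →
    (∀ i j → (transpose Q *ℚ Q) i j ≡ idℚ i j) → (∀ i → (Q ·ℚ (λ _ → ℚ.1ℚ)) i ≡ ℚ.1ℚ) →
    (∀ i j → (transpose Q *ℚ (toℚMat (skew D) *ℚ Q)) i j ≡ toℚMat (skew C) i j) →
    transpose R *ℤ walkMatrix D ≋ + ℓ • walkMatrix C
  scaled-walkMatrix D C QᵀQ≡I Qe≡e QᵀSQ≡T = walkMatrix-intertwine D C R (+ ℓ) (scaled-Gram QᵀQ≡I) Re≡ℓ RᵀSR≋ℓ²T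
    where
    open ≡-Reasoning
    Re≡ℓ : ∀ i → (R ·ℤ ones) i ≡ + ℓ
    Re≡ℓ i = toℚ-injective (begin
        toℚ ((R ·ℤ ones) i)                       ≡⟨ toℚ-scaled-* R (λ _ _ → + 1) Q (λ _ _ → ℚ.1ℚ) L ℚ.1ℚ R≡LQ (λ _ _ → refl) i i ⟩
        (L ℚ.* ℚ.1ℚ) ℚ.* (Q ·ℚ (λ _ → ℚ.1ℚ)) i   ≡⟨ cong₂ ℚ._*_ (ℚP.*-identityʳ L) (Qe≡e i) ⟩
        L ℚ.* ℚ.1ℚ                                ≡⟨ ℚP.*-identityʳ L ⟩
        L                                         ∎)
    RᵀSR≋ℓ²T : transpose R *ℤ (skew D *ℤ R) ≋ (+ ℓ * + ℓ) • skew C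
    RᵀSR≋ℓ²T i j = toℚ-injective (begin
        toℚ ((transpose R *ℤ (skew D *ℤ R)) i j)
      ≡⟨ toℚ-scaled-* (transpose R) (skew D *ℤ R) (transpose Q) (toℚMat (skew D) *ℚ Q) L (ℚ.1ℚ ℚ.* L) Rᵀ≡LQᵀ
           (toℚ-scaled-* (skew D) R (toℚMat (skew D)) Q ℚ.1ℚ L (λ k m → sym (ℚP.*-identityˡ _)) R≡LQ) i j ⟩
        (L ℚ.* (ℚ.1ℚ ℚ.* L)) ℚ.* (transpose Q *ℚ (toℚMat (skew D) *ℚ Q)) i j
      ≡⟨ cong₂ ℚ._*_ (cong (L ℚ.*_) (ℚP.*-identityˡ L)) (QᵀSQ≡T i j) ⟩
        (L ℚ.* L) ℚ.* toℚ (skew C i j)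
      ≡⟨ sym (toℚ-ℓ²* (skew C i j)) ⟩
        toℚ (+ ℓ * + ℓ * skew C i j)
      ∎)

-- If p divided every entry of R = ℓQ, then (ℓ/p)Q would be integral, contradicting the minimality of ℓ.
level-nonZeroMod : {Q : Mat ℚ n} {ℓ : ℕ} .{{_ : ℕ.NonZero ℓ}} (R : Mat ℤ n) → (∀ i j → scaleℚ ℓ Q i j ≡ toℚ (R i j)) →
  (∀ x → ℕ.NonZero x → IntegralMat (scaleℚ x Q) → ℓ ℕ.≤ x) →
  ∀ {p} → Prime p → p ℕD.∣ ℓ → NonZeroMod p R
level-nonZeroMod {n} {Q} {ℓ} R ℓQ≡R minimal {p} prime-p (ℕD.divides t ℓ≡tp) =
  map₂ (λ {i} → FinP.¬∀⟶∃¬ n _ (λ j → + p ℤS.∣? R i j)) (FinP.¬∀⟶∃¬ n _ (λ i → FinP.all? (λ j → + p ℤS.∣? R i j)) p∤R)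
  where
  instance
    p≢0 : ℕ.NonZero p
    p≢0 = prime⇒nonZero prime-p
  t≢0 : ℕ.NonZero t
  t≢0 = ℕ.≢-nonZero λ t≡0 → ℕ.≢-nonZero⁻¹ ℓ (trans ℓ≡tp (cong (ℕ._* p) t≡0))
  t<ℓ : t ℕ.< ℓ
  t<ℓ = subst (t ℕ.<_) (sym ℓ≡tp) (ℕP.m<m*n t p {{t≢0}} (ℕ.nonTrivial⇒n>1 p {{prime⇒nonTrivial prime-p}}))
  tQ-integral : (∀ i j → + p ℤS.∣ R i j) → IntegralMat (scaleℚ t Q)
  tQ-integral p∣R i j = quotient (p∣R i j) , toℚ-cancelˡ p (begin
      toℚ (+ p) ℚ.* (toℚ (+ t) ℚ.* Q i j)   ≡⟨ sym (ℚP.*-assoc (toℚ (+ p)) (toℚ (+ t)) (Q i j)) ⟩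
      toℚ (+ p) ℚ.* toℚ (+ t) ℚ.* Q i j     ≡⟨ cong (ℚ._* Q i j) (sym (toℚ-* (+ p) (+ t))) ⟩
      toℚ (+ p * + t) ℚ.* Q i j             ≡⟨ cong (λ z → toℚ z ℚ.* Q i j) (sym (ℤP.pos-* p t)) ⟩
      toℚ (+ (p ℕ.* t)) ℚ.* Q i j           ≡⟨ cong (λ z → toℚ (+ z) ℚ.* Q i j) (trans (ℕP.*-comm p t) (sym ℓ≡tp)) ⟩
      scaleℚ ℓ Q i j                        ≡⟨ ℓQ≡R i j ⟩
      toℚ (R i j)                           ≡⟨ cong toℚ (ℤS._∣_.equality (p∣R i j)) ⟩
      toℚ (quotient (p∣R i j) * + p)        ≡⟨ toℚ-* (quotient (p∣R i j)) (+ p) ⟩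
      toℚ (quotient (p∣R i j)) ℚ.* toℚ (+ p) ≡⟨ ℚP.*-comm (toℚ (quotient (p∣R i j))) (toℚ (+ p)) ⟩
      toℚ (+ p) ℚ.* toℚ (quotient (p∣R i j)) ∎)
    where open ≡-Reasoning
  p∤R : ¬ (∀ i j → + p ℤS.∣ R i j)
  p∤R p∣R = ℕP.<⇒≱ t<ℓ (minimal t t≢0 (tQ-integral p∣R))

InF⇒p²∤det : ∀ {p} → Prime p → p ≢ 2 → (D : OrientedGraph n) → InF D → ¬ (+ (p ℕ.* p) ℤS.∣ det (walkMatrix D))
InF⇒p²∤det {n} prime-p p≢2 D (m , detW≡2^km , _ , squarefree) =
  odd-prime²∤2^*squarefree prime-p p≢2 (n ℕ./ 2) m squarefree ∘ subst (_ ℤS.∣_) detW≡2^km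

module Rescaled (ℓ d : ℕ) .{{_ : ℕ.NonZero ℓ}} (R X : Mat ℤ n) (ℓX≡dR : ∀ i j → + ℓ * X i j ≡ + d * R i j) where

  private
    scale-∑ : (f g h : Fin n → ℤ) → (∀ k → + ℓ * f k ≡ + d * g k) → + ℓ * ∑ℤ (λ k → f k * h k) ≡ + d * ∑ℤ (λ k → g k * h k)
    scale-∑ f g h ℓf≡dg = trans (sym (∑-*ˡ (+ ℓ) (λ k → f k * h k)))
      (trans (∑-cong (λ k → trans (sym (ℤP.*-assoc (+ ℓ) (f k) (h k)))
                     (trans (cong (_* h k) (ℓf≡dg k)) (ℤP.*-assoc (+ d) (g k) (h k)))))
             (∑-*ˡ (+ d) (λ k → g k * h k)))

  toℚMat-rescaled : {Q : Mat ℚ n} → (∀ i j → scaleℚ ℓ Q i j ≡ toℚ (R i j)) → ∀ i j → toℚMat X i j ≡ scaleℚ d Q i j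
  toℚMat-rescaled {Q} ℓQ≡R i j = toℚ-cancelˡ ℓ (begin
      toℚ (+ ℓ) ℚ.* toℚ (X i j)                 ≡⟨ sym (toℚ-* (+ ℓ) (X i j)) ⟩
      toℚ (+ ℓ * X i j)                         ≡⟨ cong toℚ (ℓX≡dR i j) ⟩
      toℚ (+ d * R i j)                         ≡⟨ toℚ-* (+ d) (R i j) ⟩
      toℚ (+ d) ℚ.* toℚ (R i j)                 ≡⟨ cong (toℚ (+ d) ℚ.*_) (sym (ℓQ≡R i j)) ⟩
      toℚ (+ d) ℚ.* (toℚ (+ ℓ) ℚ.* Q i j)       ≡⟨ solve 3 (λ a b q → a :* (b :* q) := b :* (a :* q)) refl (toℚ (+ d)) (toℚ (+ ℓ)) (Q i j) ⟩
      toℚ (+ ℓ) ℚ.* (toℚ (+ d) ℚ.* Q i j)       ∎)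
    where
    open ≡-Reasoning
    open ℚSolver

  ᵀ*-rescaled : (M N : Mat ℤ n) → transpose R *ℤ M ≋ + ℓ • N → transpose X *ℤ M ≋ + d • N
  ᵀ*-rescaled M N RᵀM≋ℓN = •-cancel (+ ℓ) λ i j → begin
      + ℓ * (transpose X *ℤ M) i j       ≡⟨ scale-∑ (λ k → X k i) (λ k → R k i) (λ k → M k j) (λ k → ℓX≡dR k i) ⟩
      + d * (transpose R *ℤ M) i j       ≡⟨ cong (+ d *_) (RᵀM≋ℓN i j) ⟩
      + d * (+ ℓ * N i j)                ≡⟨ swap (+ d) (+ ℓ) (N i j) ⟩
      + ℓ * (+ d * N i j)                ∎
    where
    open ≡-Reasoning
    swap : ∀ a b c → a * (b * c) ≡ b * (a * c)
    swap = solve-∀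

  Gram-rescaled : transpose R *ℤ R ≋ (+ ℓ * + ℓ) • idℤ → transpose X *ℤ X ≋ (+ d * + d) • idℤ
  Gram-rescaled RᵀR≋ℓ²I = •-cancel (+ ℓ * + ℓ) {{ℤP.i*j≢0 (+ ℓ) (+ ℓ)}} λ i j → begin
      + ℓ * + ℓ * (transpose X *ℤ X) i j        ≡⟨ ℤP.*-assoc (+ ℓ) (+ ℓ) _ ⟩
      + ℓ * (+ ℓ * (transpose X *ℤ X) i j)      ≡⟨ cong (+ ℓ *_) (scale-∑ (λ k → X k i) (λ k → R k i) (λ k → X k j) (λ k → ℓX≡dR k i)) ⟩
      + ℓ * (+ d * (transpose R *ℤ X) i j)      ≡⟨ swap (+ ℓ) (+ d) _ ⟩
      + d * (+ ℓ * (transpose R *ℤ X) i j)      ≡⟨ cong (+ d *_) (cong (+ ℓ *_) (∑-cong (λ k → ℤP.*-comm (R k i) (X k j)))) ⟩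
      + d * (+ ℓ * ∑ℤ (λ k → X k j * R k i))    ≡⟨ cong (+ d *_) (scale-∑ (λ k → X k j) (λ k → R k j) (λ k → R k i) (λ k → ℓX≡dR k j)) ⟩
      + d * (+ d * ∑ℤ (λ k → R k j * R k i))    ≡⟨ cong (λ s → + d * (+ d * s)) (∑-cong (λ k → ℤP.*-comm (R k j) (R k i))) ⟩
      + d * (+ d * (transpose R *ℤ R) i j)      ≡⟨ cong (λ s → + d * (+ d * s)) (RᵀR≋ℓ²I i j) ⟩
      + d * (+ d * (+ ℓ * + ℓ * idℤ i j))       ≡⟨ regroup (+ d) (+ ℓ * + ℓ) (idℤ i j) ⟩
      + ℓ * + ℓ * (+ d * + d * idℤ i j)         ∎
    where
    open ≡-Reasoning
    swap : ∀ a b c → a * (b * c) ≡ b * (a * c)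
    swap = solve-∀
    regroup : ∀ d c e → d * (d * (c * e)) ≡ c * (d * d * e)
    regroup = solve-∀

  prime∣d : ∀ {p} → Prime p → p ℕD.∣ ℓ → NonZeroMod p R → + p ℤS.∣ + d
  prime∣d {p} prime-p p∣ℓ (i , j , p∤Rᵢⱼ) = [ (λ p∣d → p∣d) , ⊥-elim ∘ p∤Rᵢⱼ ]′
    (prime∣* prime-p (subst (+ p ℤS.∣_) (ℓX≡dR i j) (ℤS.∣m⇒∣m*n (X i j) (∣ᵤ⇒∣ {i = + ℓ} p∣ℓ))))

  nonZeroMod-rescaled : ∀ {p} → Prime p → p ℕD.∣ ℓ → ¬ (+ (p ℕ.* p) ℤS.∣ + d) → NonZeroMod p R → NonZeroMod p X
  nonZeroMod-rescaled {p} prime-p p∣ℓ p²∤d (i , j , p∤Rᵢⱼ) = i , j , λ p∣Xᵢⱼ → p²∤d (prime²∣-cancelˡ prime-p p∤Rᵢⱼ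
    (subst (+ (p ℕ.* p) ℤS.∣_) (trans (ℓX≡dR i j) (ℤP.*-comm (+ d) (R i j))) (∣∧∣⇒²∣* (∣ᵤ⇒∣ {i = + ℓ} p∣ℓ) p∣Xᵢⱼ)))

lemma8 : (n : ℕ) (D : OrientedGraph n) → InF D →
    (Q : Mat ℚ n) → InΓ D Q →
    (d : ℕ) → IsLargestInvariantFactor (walkMatrix D) d →
    (ℓ : ℕ) → IsLevel Q ℓ →
    (p : ℕ) → Prime p → p ≢ 2 → p ℕD.∣ ℓ →
    Σ (Mat ℤ n) (λ Qbar →
      (∀ i j → toℚMat Qbar i j ≡ scaleℚ d Q i j) ×
      (∀ i j → (+ (p ℕ.* p)) ℤD.∣ (transpose Qbar *ℤ Qbar) i j) ×
      HasRankMod p Qbar 1)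
lemma8 zero D _ Q _ d _ ℓ (ℓ≢0 , ℓQ-integral , minimal) p prime-p _ p∣ℓ =
  ⊥-elim (FinP.¬Fin0 (proj₁ (level-nonZeroMod {{ℓ≢0}} (λ i j → proj₁ (ℓQ-integral i j)) (λ i j → proj₂ (ℓQ-integral i j))
                                                  minimal prime-p p∣ℓ)))
lemma8 (suc m) D inF Q (QᵀQ≡I , Qe≡e , C , QᵀSQ≡T) d dₙ ℓ (ℓ≢0 , ℓQ-integral , minimal) p prime-p p≢2 p∣ℓ =
  Qbar , toℚMat-rescaled ℓQ≡R , p²∣QbarᵀQbar , rankMod≡1 prime-p Qbar W Qbar≢0 p∣QbarᵀW p²∤detW
  where
  instance
    ℓ-nonZero : ℕ.NonZero ℓ
    ℓ-nonZero = ℓ≢0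
  W : Mat ℤ (suc m)
  W = walkMatrix D
  R : Mat ℤ (suc m)
  R i j = proj₁ (ℓQ-integral i j)
  ℓQ≡R : ∀ i j → scaleℚ ℓ Q i j ≡ toℚ (R i j)
  ℓQ≡R i j = proj₂ (ℓQ-integral i j)
  open ScaledToIntegral ℓ Q R ℓQ≡R
  RᵀW≋ℓW′ : transpose R *ℤ W ≋ + ℓ • walkMatrix C
  RᵀW≋ℓW′ = scaled-walkMatrix D C QᵀQ≡I Qe≡e QᵀSQ≡T
  ℓ∣dR : ∀ i j → + ℓ ℤS.∣ + d * R i j
  ℓ∣dR i j = largestInvariantFactor-∣*W⇒∣d* W dₙ (transpose R) (walkMatrix C) RᵀW≋ℓW′ j i
  Qbar : Mat ℤ (suc m)
  Qbar i j = quotient (ℓ∣dR i j)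
  open Rescaled ℓ d R Qbar (λ i j → trans (ℤP.*-comm (+ ℓ) (Qbar i j)) (sym (ℤS._∣_.equality (ℓ∣dR i j))))
  p²∤detW : ¬ (+ (p ℕ.* p) ℤS.∣ det W)
  p²∤detW = InF⇒p²∤det prime-p p≢2 D inF
  R≢0 : NonZeroMod p R
  R≢0 = level-nonZeroMod R ℓQ≡R minimal prime-p p∣ℓ
  p∣d : + p ℤS.∣ + d
  p∣d = prime∣d prime-p p∣ℓ R≢0
  Qbar≢0 : NonZeroMod p Qbar
  Qbar≢0 = nonZeroMod-rescaled prime-p p∣ℓ (p²∤detW ∘ largestInvariantFactor-p²∣ prime-p W dₙ) R≢0
  p²∣QbarᵀQbar : ∀ i j → + (p ℕ.* p) ℤD.∣ (transpose Qbar *ℤ Qbar) i j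
  p²∣QbarᵀQbar i j =
    ∣⇒∣ᵤ (subst (_ ℤS.∣_) (sym (Gram-rescaled (scaled-Gram QᵀQ≡I) i j)) (ℤS.∣m⇒∣m*n (idℤ i j) (∣∧∣⇒²∣* p∣d p∣d)))
  p∣QbarᵀW : ∀ l c → + p ℤS.∣ (transpose Qbar *ℤ W) l c
  p∣QbarᵀW l c =
    subst (+ p ℤS.∣_) (sym (ᵀ*-rescaled W (walkMatrix C) RᵀW≋ℓW′ l c)) (ℤS.∣m⇒∣m*n (walkMatrix C l c) p∣d)
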